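{- Let $L$ be a piece or a composition and let $U$ be a piece (definitions in context). Consider the vertical 2-sums of $L$ and $U$ (with $L$ as lower and $U$ as upper summand), counted up to isomorphism. (1) If $L$ is of type CF, BF, MF or MA, then: if $U$ is MF there are $2$ nonisomorphic vertical 2-sums, both of type CF; if $U$ is MA there is $1$, of type CF; if $U$ is MC there are $2$, both of type CS; if $U$ is MX there is $1$, of type CS; if $U$ is MH there is $1$, of type CF; if $U$ is TF there are $2$, both of type CN; if $U$ is TS there is $1$, of type CN. (2) If $L$ is of type CS, BS, MC, MX or MH, then there is exactly $1$ vertical 2-sum up to isomorphism, and its type is CF if $U$ is MF or MA; CS if $U$ is MC, MX or MH; and CN if $U$ is TF or TS. (3) If $L$ is of type CN, TF or TS, there are no vertical 2-sums.
   Context: All lattices are finite. For a lattice $L$, $a(L)$ and $c(L)$ denote its numbers of atoms and coatoms. Vertical 2-sum: for disjoint lattices $L,U$ of length at least 3, $L$ with exactly two coatoms $c_1,c_2$ and $U$ with exactly two atoms $a_1,a_2$, the two vertical 2-sums are obtained by removing the top of $L$ and the bottom of $U$ and identifying $(c_1,c_2)$ with $(a_1,a_2)$ or with $(a_2,a_1)$. A lattice is a vi-lattice (vertically indecomposable) if it is not a vertical sum (top of one identified with bottom of the other) of two non-singleton lattices. Two coatoms [atoms] of a lattice with exactly two coatoms [atoms] are symmetric if some automorphism swaps them, fixed otherwise. For a graded vi-lattice $L$, its $k$-th level is the set of elements of rank $k$; a neck is a two-element level other than the level of atoms and the level of coatoms. A graded vi-lattice is a composition if it contains a neck; a piece if it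 contains no neck, has rank at least $3$, and at least one of $a(L), c(L)$ equals $2$. A piece is a middle piece if $a(L)=c(L)=2$, a bottom piece if $a(L)\ge 3$ and $c(L)=2$, a top piece if $a(L)=2$ and $c(L)\ge 3$. Middle piece types: MF if atoms and coatoms are fixed; MA if atoms symmetric and coatoms fixed; MC if atoms fixed and coatoms symmetric; MX if it has an automorphism swapping the atoms but fixing the coatoms and another automorphism swapping the coatoms but fixing the atoms; MH if not MX but it has an automorphism swapping both the atoms and the coatoms. Bottom piece types: BF if coatoms fixed, BS if coatoms symmetric. Top piece types: TF if atoms fixed, TS if atoms symmetric. Composition types: CF if it has two coatoms and they are fixed; CS if it has two coatoms and they are symmetric; CN if it has three or more coatoms. -}

module Defs where

open import Data.Nat using (ℕ; zero; suc; _∸_) renaming (_≤_ to _≤ℕ_)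
open import Data.Fin using (Fin)
open import Data.Bool using (Bool; true; false; not; T; _∨_)
open import Data.Unit using (⊤; tt)
open import Data.Empty using (⊥)
open import Data.Product using (Σ; ∃; ∃-syntax; _×_; _,_; proj₁; proj₂)
open import Data.Sum using (_⊎_; inj₁; inj₂)
open import Relation.Nullary using (¬_; Dec; yes; no; does)
open import Relation.Binary.PropositionalEquality using (_≡_; _≢_; refl; cong)
open import Relation.Binary.Definitions using (DecidableEquality)
open import Function.Bundles using (_↔_; Inverse)

record Str : Set₁ where
  field
    Carrier : Set
    _≤_     : Carrier → Carrier → Set
    _≟_     : DecidableEquality Carrier

open Str public

module _ (P : Str) where
  private
    C = Carrier P
    _≤'_ = _≤_ P

  IsLUB : C → C → C → Set
  IsLUB x y j = (x ≤' j) × (y ≤' j) × (∀ z → x ≤' z → y ≤' z → j ≤' z)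

  IsGLB : C → C → C → Set
  IsGLB x y m = (m ≤' x) × (m ≤' y) × (∀ z → z ≤' x → z ≤' y → z ≤' m)

  IsFinLattice : Set
  IsFinLattice =
      (∀ x → x ≤' x)
    × (∀ x y → x ≤' y → y ≤' x → x ≡ y)
    × (∀ x y z → x ≤' y → y ≤' z → x ≤' z)
    × (∃[ n ] (C ↔ Fin n))
    × C
    × (∀ x y → ∃[ j ] IsLUB x y j)
    × (∀ x y → ∃[ m ] IsGLB x y m)

  IsBot : C → Set
  IsBot b = ∀ y → b ≤' y

  IsTop : C → Set
  IsTop t = ∀ y → y ≤' t

  Covers : C → C → Set
  Covers x y = (x ≤' y) × (x ≢ y) × (∀ z → x ≤' z → z ≤' y → (z ≡ x) ⊎ (z ≡ y))

  IsAtom : C → Set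
  IsAtom a = ∃[ b ] (IsBot b × Covers b a)

  IsCoatom : C → Set
  IsCoatom c = ∃[ t ] (IsTop t × Covers c t)

  TwoAtoms : C → C → Set
  TwoAtoms a₁ a₂ = IsAtom a₁ × IsAtom a₂ × (a₁ ≢ a₂)
                   × (∀ a → IsAtom a → (a ≡ a₁) ⊎ (a ≡ a₂))

  TwoCoatoms : C → C → Set
  TwoCoatoms c₁ c₂ = IsCoatom c₁ × IsCoatom c₂ × (c₁ ≢ c₂)
                     × (∀ c → IsCoatom c → (c ≡ c₁) ⊎ (c ≡ c₂))

  A2 : Set
  A2 = ∃[ a₁ ] ∃[ a₂ ] TwoAtoms a₁ a₂

  C2 : Set
  C2 = ∃[ c₁ ] ∃[ c₂ ] TwoCoatoms c₁ c₂

  A≥3 : Set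
  A≥3 = ∃[ x ] ∃[ y ] ∃[ z ] (IsAtom x × IsAtom y × IsAtom z
        × (x ≢ y) × (x ≢ z) × (y ≢ z))

  C≥3 : Set
  C≥3 = ∃[ x ] ∃[ y ] ∃[ z ] (IsCoatom x × IsCoatom y × IsCoatom z
        × (x ≢ y) × (x ≢ z) × (y ≢ z))

  IsRank : (C → ℕ) → Set
  IsRank r = (∀ b → IsBot b → r b ≡ 0)
           × (∀ x y → Covers x y → r y ≡ suc (r x))

  Graded : Set
  Graded = ∃[ r ] IsRank r

  RankAtLeast3 : Set
  RankAtLeast3 = ∃[ r ] (IsRank r × ∃[ t ] (IsTop t × (3 ≤ℕ r t)))

  -- a neck: a two-element level k, other than the level of atoms (k = 1)
  -- and the level of coatoms (k = rank - 1)
  HasNeck : Set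
  HasNeck = ∃[ r ] (IsRank r × ∃[ t ] (IsTop t × ∃[ k ] ((k ≢ 1) × (k ≢ r t ∸ 1)
            × ∃[ x ] ∃[ y ] ((x ≢ y) × (r x ≡ k) × (r y ≡ k)
            × (∀ z → r z ≡ k → (z ≡ x) ⊎ (z ≡ y))))))

record _≅_ (P Q : Str) : Set where
  field
    bij  : Carrier P ↔ Carrier Q
    pres : ∀ x y → _≤_ P x y → _≤_ Q (Inverse.to bij x) (Inverse.to bij y)
    refl⁻ : ∀ x y → _≤_ Q (Inverse.to bij x) (Inverse.to bij y) → _≤_ P x y

open _≅_ public

_⟨$⟩_ : {P Q : Str} → P ≅ Q → Carrier P → Carrier Q
f ⟨$⟩ x = Inverse.to (bij f) x

Aut : Str → Set
Aut P = P ≅ P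

-- Subtypes with proof-irrelevant membership (via T of a Bool)

T-irr : ∀ {b : Bool} (p q : T b) → p ≡ q
T-irr {true} tt tt = refl

Σ-T-≟ : {A : Set} (P : A → Bool) → DecidableEquality A → DecidableEquality (Σ A (λ x → T (P x)))
Σ-T-≟ P d (x , p) (y , q) with d x y
... | no x≢y = no (λ e → x≢y (cong proj₁ e))
... | yes refl with T-irr p q
...   | refl = yes refl

⊎-≟ : {A B : Set} → DecidableEquality A → DecidableEquality B → DecidableEquality (A ⊎ B)
⊎-≟ dA dB (inj₁ x) (inj₁ y) with dA x y
... | yes refl = yes refl
... | no ne = no (λ { refl → ne refl })
⊎-≟ dA dB (inj₁ x) (inj₂ y) = no (λ ())
⊎-≟ dA dB (inj₂ x) (inj₁ y) = no (λ ())
⊎-≟ dA dB (inj₂ x) (inj₂ y) with dB x y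
... | yes refl = yes refl
... | no ne = no (λ { refl → ne refl })

-- Vertical sum of L₁ and L₂: the top of L₁ is identified with the
-- bottom b of L₂ (L₂ minus b is placed above all of L₁).

VSum : (L₁ L₂ : Str) → Carrier L₂ → Str
VSum L₁ L₂ b = record
  { Carrier = Carrier L₁ ⊎ Σ (Carrier L₂) (λ u → T (not (does (_≟_ L₂ u b))))
  ; _≤_ = le
  ; _≟_ = ⊎-≟ (_≟_ L₁) (Σ-T-≟ (λ u → not (does (_≟_ L₂ u b))) (_≟_ L₂))
  }
  where
  le : _ → _ → Set
  le (inj₁ x) (inj₁ y) = _≤_ L₁ x y
  le (inj₁ x) (inj₂ v) = ⊤
  le (inj₂ u) (inj₁ y) = ⊥
  le (inj₂ u) (inj₂ v) = _≤_ L₂ (proj₁ u) (proj₁ v)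

NonSingleton : Str → Set
NonSingleton P = Σ (Carrier P) λ x → Σ (Carrier P) λ y → x ≢ y

IsVI : Str → Set₁
IsVI P = ¬ (Σ Str λ L₁ → Σ Str λ L₂ → Σ (Carrier L₂) λ b →
           IsFinLattice L₁ × IsFinLattice L₂ × NonSingleton L₁ × NonSingleton L₂
           × IsBot L₂ b × (P ≅ VSum L₁ L₂ b))

-- Vertical 2-sum: L has top t and exactly two coatoms c₁ c₂, U has bottom
-- b and exactly two atoms a₁ a₂.  Remove t and b and identify c₁ with a₁,
-- c₂ with a₂.

V2Sum : (L U : Str) (t c₁ c₂ : Carrier L) (b a₁ a₂ : Carrier U) → Str
V2Sum L U t c₁ c₂ b a₁ a₂ = record
  { Carrier = Σ (Carrier L) (λ x → T (pL x)) ⊎ Σ (Carrier U) (λ u → T (pU u))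
  ; _≤_ = le
  ; _≟_ = ⊎-≟ (Σ-T-≟ pL (_≟_ L)) (Σ-T-≟ pU (_≟_ U))
  }
  where
  pL : Carrier L → Bool
  pL x = not (does (_≟_ L x t))
  pU : Carrier U → Bool
  pU u = not (does (_≟_ U u b) ∨ does (_≟_ U u a₁) ∨ does (_≟_ U u a₂))
  le : _ → _ → Set
  le (inj₁ x) (inj₁ y) = _≤_ L (proj₁ x) (proj₁ y)
  le (inj₁ x) (inj₂ v) = (_≤_ L (proj₁ x) c₁ × _≤_ U a₁ (proj₁ v))
                       ⊎ (_≤_ L (proj₁ x) c₂ × _≤_ U a₂ (proj₁ v))
  le (inj₂ u) (inj₁ y) = ⊥
  le (inj₂ u) (inj₂ v) = _≤_ U (proj₁ u) (proj₁ v)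

IsGradedVI : Str → Set₁
IsGradedVI P = IsFinLattice P × Graded P × IsVI P

IsComposition : Str → Set₁
IsComposition P = IsGradedVI P × HasNeck P

IsPiece : Str → Set₁
IsPiece P = IsGradedVI P × ¬ HasNeck P × RankAtLeast3 P × (A2 P ⊎ C2 P)

IsMiddlePiece IsBottomPiece IsTopPiece : Str → Set₁
IsMiddlePiece P = IsPiece P × A2 P × C2 P
IsBottomPiece P = IsPiece P × A≥3 P × C2 P
IsTopPiece    P = IsPiece P × A2 P × C≥3 P

SymAtoms SymCoatoms FixedAtoms FixedCoatoms : Str → Set
SymAtoms P = ∃[ a₁ ] ∃[ a₂ ] (TwoAtoms P a₁ a₂
             × Σ (Aut P) λ f → (f ⟨$⟩ a₁ ≡ a₂) × (f ⟨$⟩ a₂ ≡ a₁))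
SymCoatoms P = ∃[ c₁ ] ∃[ c₂ ] (TwoCoatoms P c₁ c₂
             × Σ (Aut P) λ f → (f ⟨$⟩ c₁ ≡ c₂) × (f ⟨$⟩ c₂ ≡ c₁))
FixedAtoms P = A2 P × ¬ SymAtoms P
FixedCoatoms P = C2 P × ¬ SymCoatoms P

XSym : Str → Set
XSym P = ∃[ a₁ ] ∃[ a₂ ] ∃[ c₁ ] ∃[ c₂ ] (TwoAtoms P a₁ a₂ × TwoCoatoms P c₁ c₂
  × (Σ (Aut P) λ f → (f ⟨$⟩ a₁ ≡ a₂) × (f ⟨$⟩ a₂ ≡ a₁) × (f ⟨$⟩ c₁ ≡ c₁) × (f ⟨$⟩ c₂ ≡ c₂))
  × (Σ (Aut P) λ g → (g ⟨$⟩ c₁ ≡ c₂) × (g ⟨$⟩ c₂ ≡ c₁) × (g ⟨$⟩ a₁ ≡ a₁) × (g ⟨$⟩ a₂ ≡ a₂)))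

HSym : Str → Set
HSym P = ∃[ a₁ ] ∃[ a₂ ] ∃[ c₁ ] ∃[ c₂ ] (TwoAtoms P a₁ a₂ × TwoCoatoms P c₁ c₂
  × (Σ (Aut P) λ f → (f ⟨$⟩ a₁ ≡ a₂) × (f ⟨$⟩ a₂ ≡ a₁) × (f ⟨$⟩ c₁ ≡ c₂) × (f ⟨$⟩ c₂ ≡ c₁)))

IsMF IsMA IsMC IsMX IsMH IsBF IsBS IsTF IsTS IsCF IsCS IsCN : Str → Set₁
IsMF P = IsMiddlePiece P × FixedAtoms P × FixedCoatoms P
IsMA P = IsMiddlePiece P × SymAtoms P × FixedCoatoms P
IsMC P = IsMiddlePiece P × FixedAtoms P × SymCoatoms P
IsMX P = IsMiddlePiece P × XSym P
IsMH P = IsMiddlePiece P × ¬ XSym P × HSym P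
IsBF P = IsBottomPiece P × FixedCoatoms P
IsBS P = IsBottomPiece P × SymCoatoms P
IsTF P = IsTopPiece P × FixedAtoms P
IsTS P = IsTopPiece P × SymAtoms P
IsCF P = IsComposition P × C2 P × FixedCoatoms P
IsCS P = IsComposition P × C2 P × SymCoatoms P
IsCN P = IsComposition P × C≥3 P

-- exactly two isomorphism classes, both of type X
TwoClasses : (Str → Set₁) → Str → Str → Set₁
TwoClasses X S₁ S₂ = ¬ (S₁ ≅ S₂) × X S₁ × X S₂

-- exactly one isomorphism class, of type X
OneClass : (Str → Set₁) → Str → Str → Set₁
OneClass X S₁ S₂ = (S₁ ≅ S₂) × X S₁ × X S₂

module Submission where

-- The vertical 2-sum S of L and U is a graded lattice in which c₁, c₂ (merged with the atoms of U)
-- form a neck; a vertical cut of S would cut L or U, so S is a composition, and its coatoms are those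
-- of U.  A pair of automorphisms of L and of U that permute {c₁, c₂} and {a₁, a₂} in the same way
-- glues to an isomorphism between the two 2-sums.  Conversely an isomorphism between 2-sums preserves
-- ranks, hence maps the L-part, the U-part and the neck to themselves, and restricts to such a pair.
-- So the two 2-sums are isomorphic exactly when L has a coatom swap or U an atom swap, and the coatoms
-- of S are symmetric exactly when U has a coatom swap compatible with some automorphism of L.  Reading
-- these symmetries off the types of L and U gives the table.

open import Defs
open import Data.Bool using (Bool; T; not; _∨_)
open import Data.Bool.Properties using (T?)
open import Data.Empty using (⊥; ⊥-elim)
open import Data.Fin using (Fin; zero; suc)
open import Data.List using (List; []; _∷_; length; lookup; map; _++_; deduplicate; allFin)
open import Data.List.Membership.Propositional using (_∈_)
open import Data.List.Membership.Propositional.Properties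
  using (∈-lookup; ∈-map⁺; ∈-++⁺ˡ; ∈-++⁺ʳ; ∈-deduplicate⁺; ∈-allFin)
import Data.List.Relation.Unary.All as All
open import Data.List.Relation.Unary.All.Properties using (All¬⇒¬Any)
open import Data.List.Relation.Unary.Any using (here; there; index)
open import Data.List.Relation.Unary.Any.Properties using (lookup-index)
open import Data.List.Relation.Unary.Unique.Propositional using (Unique; _∷_)
open import Data.List.Relation.Unary.Unique.DecPropositional.Properties using (deduplicate-!)
open import Data.Nat using (ℕ; zero; suc; z≤n; s≤s; s≤s⁻¹; _+_; _∸_) renaming (_≤_ to _≤ℕ_; _<_ to _<ℕ_)
open import Data.Nat.Properties
  using (n≤1+n; <-irrefl; ≤-<-trans; suc-injective; +-suc; +-identityʳ; +-∸-assoc; m≤m+n; m<m+n; <⇒≢; m<n⇒0<n∸m)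
  renaming (≤-refl to ≤ℕ-refl; ≤-trans to ≤ℕ-trans)
open import Data.Product using (Σ; ∃-syntax; _×_; _,_; proj₁; proj₂)
open import Data.Sum using (_⊎_; inj₁; inj₂; [_,_]′)
import Data.Sum as Sum
open import Data.Unit using (tt)
open import Function.Bundles using (_↔_; Inverse; mk↔ₛ′)
open import Relation.Binary.Definitions using (DecidableEquality)
open import Relation.Binary.PropositionalEquality
  using (_≡_; _≢_; refl; cong; sym; trans; subst; subst₂; module ≡-Reasoning)
open import Relation.Nullary using (¬_; Dec; yes; no; does; contradiction)
open import Relation.Nullary.Decidable using (_×-dec_; _⊎-dec_; isYes; toWitness; fromWitness)


-- Finite enumerations

Enumeration : Set → Set
Enumeration A = Σ (List A) λ xs → ∀ x → x ∈ xs

index-lookup : ∀ {A : Set} {xs : List A} → Unique xs → ∀ i (p : lookup xs i ∈ xs) → index p ≡ i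
index-lookup (_ ∷ _)      zero    (here _)  = refl
index-lookup (x∉xs ∷ _)   zero    (there p) = contradiction p (All¬⇒¬Any x∉xs)
index-lookup (x∉xs ∷ _)   (suc i) (here e)  = contradiction (sym e) (All.lookup x∉xs (∈-lookup i))
index-lookup (_ ∷ unique) (suc i) (there p) = cong suc (index-lookup unique i p)

enumeration⇒↔Fin : ∀ {A : Set} → DecidableEquality A → Enumeration A → ∃[ n ] (A ↔ Fin n)
enumeration⇒↔Fin {A} _≟_ (xs , xs-complete) =
  length ys , mk↔ₛ′ (λ x → index (∈ys x)) (lookup ys)
    (λ i → index-lookup (deduplicate-! _≟_ xs) i (∈ys (lookup ys i)))
    (λ x → sym (lookup-index (∈ys x)))
  where
  ys : List A
  ys = deduplicate _≟_ xs
  ∈ys : ∀ x → x ∈ ys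
  ∈ys x = ∈-deduplicate⁺ _≟_ (xs-complete x)

↔Fin⇒enumeration : ∀ {A : Set} {n} → A ↔ Fin n → Enumeration A
↔Fin⇒enumeration {n = n} A↔Fin = map from (allFin n) ,
  λ x → subst (_∈ map from (allFin n)) (strictlyInverseʳ x) (∈-map⁺ from (∈-allFin (to x)))
  where open Inverse A↔Fin

enumeration-⊎ : ∀ {A B : Set} → Enumeration A → Enumeration B → Enumeration (A ⊎ B)
enumeration-⊎ (xs , ∈xs) (ys , ∈ys) = map inj₁ xs ++ map inj₂ ys , λ where
  (inj₁ x) → ∈-++⁺ˡ (∈-map⁺ inj₁ (∈xs x))
  (inj₂ y) → ∈-++⁺ʳ (map inj₁ xs) (∈-map⁺ inj₂ (∈ys y))

subtype-≡ : ∀ {A : Set} {p : A → Bool} {x y : Σ A (λ a → T (p a))} → proj₁ x ≡ proj₁ y → x ≡ y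
subtype-≡ {x = a , pa} {y = .a , qa} refl = cong (a ,_) (T-irr pa qa)

enumeration-subtype : ∀ {A : Set} (p : A → Bool) → Enumeration A → Enumeration (Σ A (λ a → T (p a)))
enumeration-subtype {A} p (xs , ∈xs) = select xs , λ (a , pa) → select-∈ xs pa (∈xs a)
  where
  select : List A → List (Σ A (λ a → T (p a)))
  select [] = []
  select (a ∷ as) with T? (p a)
  ... | yes pa = (a , pa) ∷ select as
  ... | no _   = select as
  select-∈ : ∀ as {a} (pa : T (p a)) → a ∈ as → (a , pa) ∈ select as
  select-∈ (a ∷ as) pa a∈ with T? (p a) | a∈
  ... | yes qa | here refl = here (subtype-≡ refl)
  ... | no ¬pa | here refl = contradiction pa ¬pa
  ... | yes _  | there a∈as = there (select-∈ as pa a∈as)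
  ... | no _   | there a∈as = select-∈ as pa a∈as

T-not-does⁺ : ∀ {A : Set} (d : Dec A) → ¬ A → T (not (does d))
T-not-does⁺ (yes a) ¬a = ⊥-elim (¬a a)
T-not-does⁺ (no _)  _  = tt

T-not-does⁻ : ∀ {A : Set} (d : Dec A) → T (not (does d)) → ¬ A
T-not-does⁻ (no ¬a) _ = ¬a

-- Isomorphisms

module Iso {P Q : Str} (φ : P ≅ Q) where
  open Inverse (bij φ) public using (to; from)
    renaming (strictlyInverseˡ to to-from; strictlyInverseʳ to from-to)

  to-mono : ∀ x y → _≤_ P x y → _≤_ Q (to x) (to y)
  to-mono = pres φ

  to-reflects : ∀ x y → _≤_ Q (to x) (to y) → _≤_ P x y
  to-reflects = refl⁻ φ

  from-mono : ∀ x y → _≤_ Q x y → _≤_ P (from x) (from y)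
  from-mono x y x≤y = to-reflects (from x) (from y) (subst₂ (_≤_ Q) (sym (to-from x)) (sym (to-from y)) x≤y)

  to-injective : ∀ {x y} → to x ≡ to y → x ≡ y
  to-injective {x} {y} e = trans (sym (from-to x)) (trans (cong from e) (from-to y))

  from-to≡ : ∀ {x y} → to x ≡ y → from y ≡ x
  from-to≡ {x} e = trans (cong from (sym e)) (from-to x)

  from-injective : ∀ {x y} → from x ≡ from y → x ≡ y
  from-injective {x} {y} e = trans (sym (to-from x)) (trans (cong to e) (to-from y))

  to-bot : ∀ x → IsBot P x → IsBot Q (to x)
  to-bot x x-bot y = subst (_≤_ Q (to x)) (to-from y) (to-mono x (from y) (x-bot (from y)))

  to-top : ∀ x → IsTop P x → IsTop Q (to x)
  to-top x x-top y = subst (λ z → _≤_ Q z (to x)) (to-from y) (to-mono (from y) x (x-top (from y)))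

  to-covers : ∀ x y → Covers P x y → Covers Q (to x) (to y)
  to-covers x y (x≤y , x≢y , between) = to-mono x y x≤y , (λ e → x≢y (to-injective e)) , between′
    where
    between′ : ∀ z → _≤_ Q (to x) z → _≤_ Q z (to y) → (z ≡ to x) ⊎ (z ≡ to y)
    between′ z x≤z z≤y =
      Sum.map (λ e → trans (sym (to-from z)) (cong to e)) (λ e → trans (sym (to-from z)) (cong to e))
        (between (from z) (to-reflects x (from z) (subst (_≤_ Q (to x)) (sym (to-from z)) x≤z))
                          (to-reflects (from z) y (subst (λ w → _≤_ Q w (to y)) (sym (to-from z)) z≤y)))

  to-atom : ∀ x → IsAtom P x → IsAtom Q (to x)
  to-atom x (z , z-bot , z⋖x) = to z , to-bot z z-bot , to-covers z x z⋖x

≅-from-monotone-inverses : {P Q : Str} (f : Carrier P → Carrier Q) (g : Carrier Q → Carrier P) →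
                           (∀ y → f (g y) ≡ y) → (∀ x → g (f x) ≡ x) →
                           (∀ x y → _≤_ P x y → _≤_ Q (f x) (f y)) → (∀ x y → _≤_ Q x y → _≤_ P (g x) (g y)) →
                           P ≅ Q
≅-from-monotone-inverses {P} f g f∘g g∘f f-mono g-mono = record
  { bij = mk↔ₛ′ f g f∘g g∘f ; pres = f-mono
  ; refl⁻ = λ x y fx≤fy → subst₂ (_≤_ P) (g∘f x) (g∘f y) (g-mono (f x) (f y) fx≤fy) }

≅-refl : (P : Str) → P ≅ P
≅-refl P = ≅-from-monotone-inverses (λ x → x) (λ x → x) (λ _ → refl) (λ _ → refl) (λ _ _ h → h) (λ _ _ h → h)

≅-sym : {P Q : Str} → P ≅ Q → Q ≅ P
≅-sym φ = ≅-from-monotone-inverses from to from-to to-from from-mono to-mono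
  where open Iso φ

≅-trans : {P Q R : Str} → P ≅ Q → Q ≅ R → P ≅ R
≅-trans φ ψ = ≅-from-monotone-inverses (λ x → Ψ.to (Φ.to x)) (λ z → Φ.from (Ψ.from z))
  (λ z → trans (cong Ψ.to (Φ.to-from (Ψ.from z))) (Ψ.to-from z))
  (λ x → trans (cong Φ.from (Ψ.from-to (Φ.to x))) (Φ.from-to x))
  (λ x y h → Ψ.to-mono _ _ (Φ.to-mono x y h)) (λ x y h → Φ.from-mono _ _ (Ψ.from-mono x y h))
  where
  module Φ = Iso φ
  module Ψ = Iso ψ

record Retract (P S : Str) : Set where
  field
    embed         : Carrier P → Carrier S
    retract       : Carrier S → Carrier P
    embed-mono    : ∀ x y → _≤_ P x y → _≤_ S (embed x) (embed y)
    retract-mono  : ∀ s s′ → _≤_ S s s′ → _≤_ P (retract s) (retract s′)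
    retract-embed : ∀ x → retract (embed x) ≡ x

MapsInto : {P P′ S S′ : Str} → Retract P S → Retract P′ S′ → (Carrier S → Carrier S′) → Set
MapsInto ρ ρ′ f = ∀ x → f (embed ρ x) ≡ embed ρ′ (retract ρ′ (f (embed ρ x)))
  where open Retract

module _ {P P′ S S′ : Str} (ρ : Retract P S) (ρ′ : Retract P′ S′) where
  open Retract

  restrict-≅ : (φ : S ≅ S′) → MapsInto ρ ρ′ (φ ⟨$⟩_) → MapsInto ρ′ ρ (Iso.from φ) → P ≅ P′
  restrict-≅ φ φ-into φ⁻¹-into =
    ≅-from-monotone-inverses f g f∘g g∘f
      (λ x y x≤y → retract-mono ρ′ _ _ (to-mono _ _ (embed-mono ρ x y x≤y)))
      (λ x y x≤y → retract-mono ρ _ _ (from-mono _ _ (embed-mono ρ′ x y x≤y)))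
    where
    open Iso φ
    open ≡-Reasoning
    f : Carrier P → Carrier P′
    f x = retract ρ′ (to (embed ρ x))
    g : Carrier P′ → Carrier P
    g y = retract ρ (from (embed ρ′ y))
    f∘g : ∀ y → f (g y) ≡ y
    f∘g y = begin
      retract ρ′ (to (embed ρ (retract ρ (from (embed ρ′ y))))) ≡⟨ cong (λ s → retract ρ′ (to s)) (sym (φ⁻¹-into y)) ⟩
      retract ρ′ (to (from (embed ρ′ y)))                        ≡⟨ cong (retract ρ′) (to-from _) ⟩
      retract ρ′ (embed ρ′ y)                                    ≡⟨ retract-embed ρ′ y ⟩
      y                                                          ∎
    g∘f : ∀ x → g (f x) ≡ x
    g∘f x = begin
      retract ρ (from (embed ρ′ (retract ρ′ (to (embed ρ x))))) ≡⟨ cong (λ s → retract ρ (from s)) (sym (φ-into x)) ⟩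
      retract ρ (from (to (embed ρ x)))                          ≡⟨ cong (retract ρ) (from-to _) ⟩
      retract ρ (embed ρ x)                                      ≡⟨ retract-embed ρ x ⟩
      x                                                          ∎

-- Exact pairs and their symmetries

ExactPair : {C : Set} → (C → Set) → C → C → Set
ExactPair Q x₁ x₂ = Q x₁ × Q x₂ × (x₁ ≢ x₂) × (∀ x → Q x → (x ≡ x₁) ⊎ (x ≡ x₂))

Fixes Swaps : {C : Set} → (C → C) → C → C → Set
Fixes f x₁ x₂ = (f x₁ ≡ x₁) × (f x₂ ≡ x₂)
Swaps f x₁ x₂ = (f x₁ ≡ x₂) × (f x₂ ≡ x₁)

module _ {C : Set} {Q : C → Set} where

  exactPair-swap : ∀ {x₁ x₂} → ExactPair Q x₁ x₂ → ExactPair Q x₂ x₁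
  exactPair-swap (q₁ , q₂ , x₁≢x₂ , only) = q₂ , q₁ , (λ e → x₁≢x₂ (sym e)) , λ x q → Sum.swap (only x q)

  exactPair-unique : ∀ {x₁ x₂ y₁ y₂} → ExactPair Q x₁ x₂ → ExactPair Q y₁ y₂ →
                     ((y₁ ≡ x₁) × (y₂ ≡ x₂)) ⊎ ((y₁ ≡ x₂) × (y₂ ≡ x₁))
  exactPair-unique (_ , _ , _ , only) (q₁ , q₂ , y₁≢y₂ , _) with only _ q₁ | only _ q₂
  ... | inj₁ e₁ | inj₁ e₂ = ⊥-elim (y₁≢y₂ (trans e₁ (sym e₂)))
  ... | inj₁ e₁ | inj₂ e₂ = inj₁ (e₁ , e₂)
  ... | inj₂ e₁ | inj₁ e₂ = inj₂ (e₁ , e₂)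
  ... | inj₂ e₁ | inj₂ e₂ = ⊥-elim (y₁≢y₂ (trans e₁ (sym e₂)))

  exactPair-permuted : ∀ {x₁ x₂} (f : C → C) → (∀ {x y} → f x ≡ f y → x ≡ y) → (∀ x → Q x → Q (f x)) →
                       ExactPair Q x₁ x₂ → Fixes f x₁ x₂ ⊎ Swaps f x₁ x₂
  exactPair-permuted f f-injective f-pres (q₁ , q₂ , x₁≢x₂ , only)
    with only _ (f-pres _ q₁) | only _ (f-pres _ q₂)
  ... | inj₁ e₁ | inj₁ e₂ = ⊥-elim (x₁≢x₂ (f-injective (trans e₁ (sym e₂))))
  ... | inj₁ e₁ | inj₂ e₂ = inj₁ (e₁ , e₂)
  ... | inj₂ e₁ | inj₁ e₂ = inj₂ (e₁ , e₂)
  ... | inj₂ e₁ | inj₂ e₂ = ⊥-elim (x₁≢x₂ (f-injective (trans e₁ (sym e₂))))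

  ¬exactPair-of-three : ∀ {x y z x₁ x₂} → Q x → Q y → Q z → x ≢ y → x ≢ z → y ≢ z → ¬ ExactPair Q x₁ x₂
  ¬exactPair-of-three qx qy qz x≢y x≢z y≢z (_ , _ , _ , only) with only _ qx | only _ qy | only _ qz
  ... | inj₁ e₁ | inj₁ e₂ | _       = x≢y (trans e₁ (sym e₂))
  ... | inj₂ e₁ | inj₂ e₂ | _       = x≢y (trans e₁ (sym e₂))
  ... | inj₁ e₁ | inj₂ e₂ | inj₁ e₃ = x≢z (trans e₁ (sym e₃))
  ... | inj₁ _  | inj₂ e₂ | inj₂ e₃ = y≢z (trans e₂ (sym e₃))
  ... | inj₂ _  | inj₁ e₂ | inj₁ e₃ = y≢z (trans e₂ (sym e₃))
  ... | inj₂ e₁ | inj₁ _  | inj₂ e₃ = x≢z (trans e₁ (sym e₃))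

module _ {C : Set} {f : C → C} {x₁ x₂ y₁ y₂ : C} where

  swaps-samePair : Swaps f x₁ x₂ → ((y₁ ≡ x₁) × (y₂ ≡ x₂)) ⊎ ((y₁ ≡ x₂) × (y₂ ≡ x₁)) → Swaps f y₁ y₂
  swaps-samePair (e₁ , e₂) (inj₁ (refl , refl)) = e₁ , e₂
  swaps-samePair (e₁ , e₂) (inj₂ (refl , refl)) = e₂ , e₁

  fixes-samePair : Fixes f x₁ x₂ → ((y₁ ≡ x₁) × (y₂ ≡ x₂)) ⊎ ((y₁ ≡ x₂) × (y₂ ≡ x₁)) → Fixes f y₁ y₂
  fixes-samePair (e₁ , e₂) (inj₁ (refl , refl)) = e₁ , e₂
  fixes-samePair (e₁ , e₂) (inj₂ (refl , refl)) = e₂ , e₁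

module _ {P : Str} where

  aut-permutes-atoms : ∀ {a₁ a₂} (f : Aut P) → TwoAtoms P a₁ a₂ → Fixes (f ⟨$⟩_) a₁ a₂ ⊎ Swaps (f ⟨$⟩_) a₁ a₂
  aut-permutes-atoms f = exactPair-permuted (f ⟨$⟩_) (Iso.to-injective f) (Iso.to-atom f)

  symAtoms-swaps : ∀ {a₁ a₂} → SymAtoms P → TwoAtoms P a₁ a₂ → Σ (Aut P) λ f → Swaps (f ⟨$⟩_) a₁ a₂
  symAtoms-swaps (_ , _ , pair , f , swaps) pair′ = f , swaps-samePair swaps (exactPair-unique pair pair′)

  symCoatoms-swaps : ∀ {c₁ c₂} → SymCoatoms P → TwoCoatoms P c₁ c₂ → Σ (Aut P) λ f → Swaps (f ⟨$⟩_) c₁ c₂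
  symCoatoms-swaps (_ , _ , pair , f , swaps) pair′ = f , swaps-samePair swaps (exactPair-unique pair pair′)

  xSym-swapsCoatoms : ∀ {a₁ a₂ c₁ c₂} → XSym P → TwoAtoms P a₁ a₂ → TwoCoatoms P c₁ c₂ →
                      Σ (Aut P) λ g → Swaps (g ⟨$⟩_) c₁ c₂ × Fixes (g ⟨$⟩_) a₁ a₂
  xSym-swapsCoatoms (_ , _ , _ , _ , atoms , coatoms , _ , (g , g₁ , g₂ , g₃ , g₄)) atoms′ coatoms′ =
    g , swaps-samePair (g₁ , g₂) (exactPair-unique coatoms coatoms′) ,
        fixes-samePair (g₃ , g₄) (exactPair-unique atoms atoms′)

  xSym-swapsAtoms : ∀ {a₁ a₂} → XSym P → TwoAtoms P a₁ a₂ → Σ (Aut P) λ f → Swaps (f ⟨$⟩_) a₁ a₂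
  xSym-swapsAtoms (_ , _ , _ , _ , atoms , _ , (f , f₁ , f₂ , _) , _) atoms′ =
    f , swaps-samePair (f₁ , f₂) (exactPair-unique atoms atoms′)

  hSym-swapsBoth : ∀ {a₁ a₂ c₁ c₂} → HSym P → TwoAtoms P a₁ a₂ → TwoCoatoms P c₁ c₂ →
                   Σ (Aut P) λ f → Swaps (f ⟨$⟩_) a₁ a₂ × Swaps (f ⟨$⟩_) c₁ c₂
  hSym-swapsBoth (_ , _ , _ , _ , atoms , coatoms , (f , f₁ , f₂ , f₃ , f₄)) atoms′ coatoms′ =
    f , swaps-samePair (f₁ , f₂) (exactPair-unique atoms atoms′) ,
        swaps-samePair (f₃ , f₄) (exactPair-unique coatoms coatoms′)

  ¬twoCoatoms : C≥3 P → ¬ (Σ (Carrier P) λ c₁ → Σ (Carrier P) λ c₂ → TwoCoatoms P c₁ c₂)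
  ¬twoCoatoms (_ , _ , _ , cx , cy , cz , x≢y , x≢z , y≢z) (_ , _ , pair) =
    ¬exactPair-of-three cx cy cz x≢y x≢z y≢z pair

-- Finite lattices

dual : Str → Str
dual P = record { Carrier = Carrier P ; _≤_ = λ x y → _≤_ P y x ; _≟_ = _≟_ P }

module _ {P : Str} where

  dual-isFinLattice : IsFinLattice P → IsFinLattice (dual P)
  dual-isFinLattice (reflexive , antisymmetric , transitive , finite , inhabitant , joins , meets) =
    reflexive , (λ x y p q → antisymmetric x y q p) , (λ x y z p q → transitive z y x q p) ,
    finite , inhabitant , meets , joins

  dual-covers : ∀ {x y} → Covers (dual P) y x → Covers P x y
  dual-covers (x≤y , y≢x , between) = x≤y , (λ e → y≢x (sym e)) , λ z x≤z z≤y → Sum.swap (between z z≤y x≤z)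

  covers-dual : ∀ {x y} → Covers P x y → Covers (dual P) y x
  covers-dual (x≤y , x≢y , between) = x≤y , (λ e → x≢y (sym e)) , λ z z≤y x≤z → Sum.swap (between z x≤z z≤y)

  dual-coatom : ∀ {a} → IsAtom P a → IsCoatom (dual P) a
  dual-coatom (b , b-bot , b⋖a) = b , b-bot , covers-dual b⋖a

  dual-twoCoatoms : ∀ {a₁ a₂} → TwoAtoms P a₁ a₂ → TwoCoatoms (dual P) a₁ a₂
  dual-twoCoatoms (a₁-atom , a₂-atom , a₁≢a₂ , only) =
    dual-coatom a₁-atom , dual-coatom a₂-atom , a₁≢a₂ ,
    λ a (b , b-bot , a⋖b) → only a (b , b-bot , dual-covers a⋖b)

-- Kept apart from FinLattice so that it can also be instantiated at the dual lattice.
module FinLatticeCore (P : Str) (FL : IsFinLattice P) where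
  C = Carrier P
  _⊑_ = Defs._≤_ P
  _≡?_ = Defs._≟_ P

  ⊑-refl : ∀ x → x ⊑ x
  ⊑-refl = proj₁ FL
  ⊑-antisym : ∀ x y → x ⊑ y → y ⊑ x → x ≡ y
  ⊑-antisym = proj₁ (proj₂ FL)
  ⊑-trans : ∀ x y z → x ⊑ y → y ⊑ z → x ⊑ z
  ⊑-trans = proj₁ (proj₂ (proj₂ FL))
  inhabitant : C
  inhabitant = proj₁ (proj₂ (proj₂ (proj₂ (proj₂ FL))))
  joins : ∀ x y → ∃[ j ] IsLUB P x y j
  joins = proj₁ (proj₂ (proj₂ (proj₂ (proj₂ (proj₂ FL)))))
  meets : ∀ x y → ∃[ m ] IsGLB P x y m
  meets = proj₂ (proj₂ (proj₂ (proj₂ (proj₂ (proj₂ FL)))))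

  elements : Enumeration C
  elements = ↔Fin⇒enumeration (proj₂ (proj₁ (proj₂ (proj₂ (proj₂ FL)))))

  ⊑-reflexive : ∀ {x y} → x ≡ y → x ⊑ y
  ⊑-reflexive {x} refl = ⊑-refl x

  _⊑?_ : ∀ x y → Dec (x ⊑ y)
  x ⊑? y with joins x y
  ... | j , x⊑j , y⊑j , least with j ≡? y
  ...   | yes refl = yes x⊑j
  ...   | no j≢y   = no λ x⊑y → j≢y (⊑-antisym j y (least y x⊑y (⊑-refl y)) y⊑j)

  _⊏_ : C → C → Set
  x ⊏ y = x ⊑ y × x ≢ y

  _⊏?_ : ∀ x y → Dec (x ⊏ y)
  x ⊏? y with x ⊑? y | x ≡? y
  ... | yes x⊑y | no x≢y = yes (x⊑y , x≢y)
  ... | yes _   | yes e  = no λ (_ , x≢y) → x≢y e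
  ... | no x⋢y  | _      = no λ (x⊑y , _) → x⋢y x⊑y

  private
    maximalBelow : ∀ z (ws : List C) y → y ⊏ z →
                   Σ C λ m → y ⊑ m × m ⊏ z × (∀ w → w ∈ ws → ¬ (m ⊏ w × w ⊏ z))
    maximalBelow z [] y y⊏z = y , ⊑-refl y , y⊏z , λ _ ()
    maximalBelow z (w ∷ ws) y y⊏z with y ⊏? w | w ⊏? z
    ... | yes y⊏w | yes w⊏z =
      let m , w⊑m , m⊏z , maximal = maximalBelow z ws w w⊏z in
      m , ⊑-trans y w m (proj₁ y⊏w) w⊑m , m⊏z , λ where
        v (here refl) ((m⊑v , m≢v) , _) → m≢v (⊑-antisym m v m⊑v w⊑m)
        v (there v∈ws)                 → maximal v v∈ws
    ... | no y⊀w | _ =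
      let m , y⊑m , m⊏z , maximal = maximalBelow z ws y y⊏z in
      m , y⊑m , m⊏z , λ where
        v (here refl) ((m⊑v , m≢v) , _) →
          y⊀w (⊑-trans y m v y⊑m m⊑v , λ { refl → m≢v (⊑-antisym m y m⊑v y⊑m) })
        v (there v∈ws) → maximal v v∈ws
    ... | yes _ | no w⊀z =
      let m , y⊑m , m⊏z , maximal = maximalBelow z ws y y⊏z in
      m , y⊑m , m⊏z , λ where
        v (here refl) (_ , v⊏z) → w⊀z v⊏z
        v (there v∈ws)          → maximal v v∈ws

  coveredBelow : ∀ x z → x ⊑ z → x ≢ z → Σ C λ y → x ⊑ y × Covers P y z
  coveredBelow x z x⊑z x≢z with maximalBelow z (proj₁ elements) x (x⊑z , x≢z)
  ... | y , x⊑y , (y⊑z , y≢z) , maximal = y , x⊑y , y⊑z , y≢z , between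
    where
    between : ∀ w → y ⊑ w → w ⊑ z → (w ≡ y) ⊎ (w ≡ z)
    between w y⊑w w⊑z with w ≡? y | w ≡? z
    ... | yes e | _     = inj₁ e
    ... | no _  | yes e = inj₂ e
    ... | no w≢y | no w≢z =
      ⊥-elim (maximal w (proj₂ elements w) ((y⊑w , λ e → w≢y (sym e)) , (w⊑z , w≢z)))

  private
    lowerBound : (ws : List C) → Σ C λ m → ∀ w → w ∈ ws → m ⊑ w
    lowerBound [] = inhabitant , λ _ ()
    lowerBound (w ∷ ws) =
      let m , m⊑ws = lowerBound ws
          m′ , m′⊑m , m′⊑w , _ = meets m w
      in m′ , λ where
        v (here refl)  → m′⊑w
        v (there v∈ws) → ⊑-trans m′ m v m′⊑m (m⊑ws v v∈ws)

  bot : C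
  bot = proj₁ (lowerBound (proj₁ elements))

  bot-isBot : IsBot P bot
  bot-isBot y = proj₂ (lowerBound (proj₁ elements)) y (proj₂ elements y)

  bot-unique : ∀ {b b′} → IsBot P b → IsBot P b′ → b ≡ b′
  bot-unique {b} {b′} b-bot b′-bot = ⊑-antisym b b′ (b-bot b′) (b′-bot b)

  top-unique : ∀ {t t′} → IsTop P t → IsTop P t′ → t ≡ t′
  top-unique {t} {t′} t-top t′-top = ⊑-antisym t t′ (t′-top t) (t-top t′)

  coatom-covered : ∀ {t c} → IsTop P t → IsCoatom P c → Covers P c t
  coatom-covered t-top (t′ , t′-top , c⋖t′) = subst (Covers P _) (top-unique t′-top t-top) c⋖t′

  above-coatom : ∀ {t c w} → IsTop P t → IsCoatom P c → c ⊑ w → (w ≡ c) ⊎ (w ≡ t)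
  above-coatom t-top c-coatom c⊑w = proj₂ (proj₂ (coatom-covered t-top c-coatom)) _ c⊑w (t-top _)

  coatom≢top : ∀ {t c} → IsTop P t → IsCoatom P c → c ≢ t
  coatom≢top t-top c-coatom = proj₁ (proj₂ (coatom-covered t-top c-coatom))

  coatoms-incomparable : ∀ {t c₁ c₂} → IsTop P t → TwoCoatoms P c₁ c₂ → ¬ (c₁ ⊑ c₂)
  coatoms-incomparable t-top (c₁-coatom , c₂-coatom , c₁≢c₂ , _) c₁≤c₂
    with above-coatom t-top c₁-coatom c₁≤c₂
  ... | inj₁ e = c₁≢c₂ (sym e)
  ... | inj₂ e = coatom≢top t-top c₂-coatom e

  below-coatoms : ∀ {t c₁ c₂ x} → IsTop P t → TwoCoatoms P c₁ c₂ → x ≢ t → (x ⊑ c₁) ⊎ (x ⊑ c₂)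
  below-coatoms {t} {x = x} t-top (_ , _ , _ , only) x≢t with coveredBelow x t (t-top x) x≢t
  ... | y , x⊑y , y⋖t = Sum.map (λ { refl → x⊑y }) (λ { refl → x⊑y }) (only y (t , t-top , y⋖t))

module FinLattice (P : Str) (FL : IsFinLattice P) where
  open FinLatticeCore P FL public
  private
    module D = FinLatticeCore (dual P) (dual-isFinLattice {P} FL)

  top : C
  top = D.bot

  top-isTop : IsTop P top
  top-isTop = D.bot-isBot

  below-atom : ∀ {b a w} → IsBot P b → IsAtom P a → w ⊑ a → (w ≡ a) ⊎ (w ≡ b)
  below-atom b-bot a-atom = D.above-coatom b-bot (dual-coatom {P} a-atom)

  atom≢bot : ∀ {b a} → IsBot P b → IsAtom P a → a ≢ b
  atom≢bot b-bot a-atom = D.coatom≢top b-bot (dual-coatom {P} a-atom)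

  atoms-incomparable : ∀ {b a₁ a₂} → IsBot P b → TwoAtoms P a₁ a₂ → ¬ (a₂ ⊑ a₁)
  atoms-incomparable b-bot atoms = D.coatoms-incomparable b-bot (dual-twoCoatoms {P} atoms)

  above-atoms : ∀ {b a₁ a₂ x} → IsBot P b → TwoAtoms P a₁ a₂ → x ≢ b → (a₁ ⊑ x) ⊎ (a₂ ⊑ x)
  above-atoms b-bot atoms = D.below-coatoms b-bot (dual-twoCoatoms {P} atoms)

module _ (P : Str) where
  private
    _⊑_ = Defs._≤_ P

  joins-from-meets : (∀ x y z → x ⊑ y → y ⊑ z → x ⊑ z) → (∀ x y → Dec (x ⊑ y)) →
                     Enumeration (Carrier P) → ∀ t → IsTop P t → (∀ x y → ∃[ m ] IsGLB P x y m) →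
                     ∀ x y → ∃[ j ] IsLUB P x y j
  joins-from-meets ⊑-trans _⊑?_ (xs , ∈xs) t t-top meets x y =
    let j , x⊑j , y⊑j , least = meetOfUpperBounds xs in j , x⊑j , y⊑j , λ z x⊑z y⊑z → least z (∈xs z) x⊑z y⊑z
    where
    meetOfUpperBounds : (zs : List (Carrier P)) →
      Σ (Carrier P) λ m → x ⊑ m × y ⊑ m × (∀ z → z ∈ zs → x ⊑ z → y ⊑ z → m ⊑ z)
    meetOfUpperBounds [] = t , t-top x , t-top y , λ _ ()
    meetOfUpperBounds (z ∷ zs) with meetOfUpperBounds zs | x ⊑? z ×-dec y ⊑? z
    ... | m , x⊑m , y⊑m , least | no ¬bound =
      m , x⊑m , y⊑m , λ where
        w (here refl) x⊑w y⊑w → ⊥-elim (¬bound (x⊑w , y⊑w))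
        w (there w∈zs)        → least w w∈zs
    ... | m , x⊑m , y⊑m , least | yes (x⊑z , y⊑z) =
      let m′ , m′⊑m , m′⊑z , greatest = meets m z in
      m′ , greatest x x⊑m x⊑z , greatest y y⊑m y⊑z , λ where
        w (here refl) _ _     → m′⊑z
        w (there w∈zs) x⊑w y⊑w → ⊑-trans m′ m w m′⊑m (least w w∈zs x⊑w y⊑w)

-- Rank functions

n≢0⇒n≢1⇒2≤n : ∀ k → k ≢ 0 → k ≢ 1 → 2 ≤ℕ k
n≢0⇒n≢1⇒2≤n zero          k≢0 _   = ⊥-elim (k≢0 refl)
n≢0⇒n≢1⇒2≤n (suc zero)    _   k≢1 = ⊥-elim (k≢1 refl)
n≢0⇒n≢1⇒2≤n (suc (suc _)) _   _   = s≤s (s≤s z≤n)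

module Ranked (P : Str) (FL : IsFinLattice P) (r : Carrier P → ℕ) (R : IsRank P r) where
  open FinLattice P FL public

  rank-bot : ∀ {b} → IsBot P b → r b ≡ 0
  rank-bot = proj₁ R _

  rank-covers : ∀ {x y} → Covers P x y → r y ≡ suc (r x)
  rank-covers = proj₂ R _ _

  private
    rank-mono-below : ∀ n x z → r z ≤ℕ n → x ⊑ z → r x ≤ℕ r z
    rank-mono-below n x z _ x⊑z with x ≡? z
    ... | yes refl = ≤ℕ-refl
    ... | no x≢z with coveredBelow x z x⊑z x≢z
    ...   | y , x⊑y , y⋖z with rank-covers y⋖z
    rank-mono-below zero    _ _ rz≤0 _ | no _ | _ | rz≡ with () ← subst (_≤ℕ 0) rz≡ rz≤0
    rank-mono-below (suc n) x z rz≤n _ | no _ | y , x⊑y , _ | rz≡ =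
      ≤ℕ-trans (rank-mono-below n x y (s≤s⁻¹ (subst (_≤ℕ suc n) rz≡ rz≤n)) x⊑y)
               (subst (r y ≤ℕ_) (sym rz≡) (n≤1+n (r y)))

  rank-mono : ∀ x z → x ⊑ z → r x ≤ℕ r z
  rank-mono x z = rank-mono-below (r z) x z ≤ℕ-refl

  rank-strict : ∀ x z → x ⊑ z → x ≢ z → r x <ℕ r z
  rank-strict x z x⊑z x≢z with coveredBelow x z x⊑z x≢z
  ... | y , x⊑y , y⋖z = subst (r x <ℕ_) (sym (rank-covers y⋖z)) (s≤s (rank-mono x y x⊑y))

  private
    rank-unique-below : ∀ r′ → IsRank P r′ → ∀ n x → r x ≤ℕ n → r′ x ≡ r x
    rank-unique-below r′ R′ n x _ with x ≡? bot
    ... | yes refl = trans (proj₁ R′ bot bot-isBot) (sym (rank-bot bot-isBot))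
    ... | no x≢bot with coveredBelow bot x (bot-isBot x) (λ e → x≢bot (sym e))
    ...   | y , _ , y⋖x with rank-covers y⋖x
    rank-unique-below r′ R′ zero    x rx≤0 | no _ | _ | rx≡ with () ← subst (_≤ℕ 0) rx≡ rx≤0
    rank-unique-below r′ R′ (suc n) x rx≤n | no _ | y , _ , y⋖x | rx≡ =
      trans (proj₂ R′ y x y⋖x)
            (trans (cong suc (rank-unique-below r′ R′ n y (s≤s⁻¹ (subst (_≤ℕ suc n) rx≡ rx≤n)))) (sym rx≡))

  rank-unique : ∀ r′ → IsRank P r′ → ∀ x → r′ x ≡ r x
  rank-unique r′ R′ x = rank-unique-below r′ R′ (r x) x ≤ℕ-refl

  rank≡0⇒bot : ∀ {b x} → IsBot P b → r x ≡ 0 → x ≡ b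
  rank≡0⇒bot {b} {x} b-bot rx≡0 with x ≡? b
  ... | yes x≡b = x≡b
  ... | no x≢b = ⊥-elim (<-irrefl refl (subst (0 <ℕ_) rx≡0 0<rx))
    where
    0<rx : 0 <ℕ r x
    0<rx = subst (_<ℕ r x) (rank-bot b-bot) (rank-strict b x (b-bot x) (λ e → x≢b (sym e)))

  rank-atom : ∀ {a} → IsAtom P a → r a ≡ 1
  rank-atom (_ , b-bot , b⋖a) = trans (rank-covers b⋖a) (cong suc (rank-bot b-bot))

  rank≡1⇒atom : ∀ {x} → r x ≡ 1 → IsAtom P x
  rank≡1⇒atom {x} rx≡1 = bot , bot-isBot , bot-isBot x , bot≢x , between
    where
    bot≢x : bot ≢ x
    bot≢x e with () ← trans (sym (rank-bot bot-isBot)) (trans (cong r e) rx≡1)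
    between : ∀ z → bot ⊑ z → z ⊑ x → (z ≡ bot) ⊎ (z ≡ x)
    between z bot⊑z z⊑x with z ≡? bot | z ≡? x
    ... | yes e | _ = inj₁ e
    ... | no _ | yes e = inj₂ e
    ... | no z≢bot | no z≢x with rank-strict bot z bot⊑z (λ e → z≢bot (sym e)) | rank-strict z x z⊑x z≢x
    ...   | 0<rz | rz<1 = ⊥-elim (<-irrefl refl (≤-<-trans (subst (_<ℕ r z) (rank-bot bot-isBot) 0<rz)
                                                    (subst (r z <ℕ_) rx≡1 rz<1)))

  rank-coatom : ∀ {t c} → IsTop P t → IsCoatom P c → r t ≡ suc (r c)
  rank-coatom t-top c-coatom = rank-covers (coatom-covered t-top c-coatom)

  rank≥3 : ∀ {t} → IsTop P t → RankAtLeast3 P → 3 ≤ℕ r t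
  rank≥3 t-top (r′ , R′ , t′ , t′-top , 3≤r′t′) =
    subst (3 ≤ℕ_) (trans (rank-unique r′ R′ t′) (cong r (top-unique t′-top t-top))) 3≤r′t′

  neck⇒rank≥3 : ∀ {t} → IsTop P t → HasNeck P → 3 ≤ℕ r t
  neck⇒rank≥3 {t} t-top (r′ , R′ , _ , _ , k , k≢1 , _ , x , y , x≢y , r′x≡k , r′y≡k , _) = above-neck (x ≡? t)
    where
    rx≡k : r x ≡ k
    rx≡k = trans (sym (rank-unique r′ R′ x)) r′x≡k
    ry≡k : r y ≡ k
    ry≡k = trans (sym (rank-unique r′ R′ y)) r′y≡k
    2≤k : 2 ≤ℕ k
    2≤k = n≢0⇒n≢1⇒2≤n k
            (λ k≡0 → x≢y (trans (rank≡0⇒bot bot-isBot (trans rx≡k k≡0))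
                               (sym (rank≡0⇒bot bot-isBot (trans ry≡k k≡0)))))
            k≢1
    above-neck : Dec (x ≡ t) → 3 ≤ℕ r t
    above-neck (no x≢t)  = ≤-<-trans (subst (2 ≤ℕ_) (sym rx≡k) 2≤k) (rank-strict x t (t-top x) x≢t)
    above-neck (yes x≡t) =
      ≤-<-trans (subst (2 ≤ℕ_) (sym ry≡k) 2≤k) (rank-strict y t (t-top y) (λ e → x≢y (trans x≡t (sym e))))

isRank-transport : ∀ {P Q r} (φ : P ≅ Q) → IsRank Q r → IsRank P (λ x → r (φ ⟨$⟩ x))
isRank-transport φ (rank-bot , rank-covers) =
  (λ x x-bot → rank-bot _ (Iso.to-bot φ x x-bot)) , (λ x y x⋖y → rank-covers _ _ (Iso.to-covers φ x y x⋖y))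

-- Vertical sums

module VerticalCut (P : Str) (FL : IsFinLattice P) (x : Carrier P)
                   (comparable : ∀ y → Defs._≤_ P y x ⊎ Defs._≤_ P x y) where
  open FinLattice P FL

  private
    below above : C → Bool
    below y = isYes (y ⊑? x)
    above y = isYes (x ⊑? y)

    ↓-intro : ∀ {y} → y ⊑ x → T (below y)
    ↓-intro {y} = fromWitness {a? = y ⊑? x}
    ↓-elim : ∀ {y} → T (below y) → y ⊑ x
    ↓-elim {y} = toWitness {a? = y ⊑? x}
    ↑-intro : ∀ {y} → x ⊑ y → T (above y)
    ↑-intro {y} = fromWitness {a? = x ⊑? y}
    ↑-elim : ∀ {y} → T (above y) → x ⊑ y
    ↑-elim {y} = toWitness {a? = x ⊑? y}

    subposet : (C → Bool) → Str
    subposet p = record { Carrier = Σ C (λ y → T (p y)) ; _≤_ = λ u v → proj₁ u ⊑ proj₁ v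
                        ; _≟_ = Σ-T-≟ p _≡?_ }

  Down Up : Str
  Down = subposet below
  Up   = subposet above

  x↑ : Carrier Up
  x↑ = x , ↑-intro (⊑-refl x)

  Down-lattice : IsFinLattice Down
  Down-lattice =
    (λ u → ⊑-refl (proj₁ u)) , (λ u v p q → subtype-≡ (⊑-antisym _ _ p q)) , (λ u v w → ⊑-trans _ _ _) ,
    enumeration⇒↔Fin (Σ-T-≟ below _≡?_) (enumeration-subtype below elements) ,
    (x , ↓-intro (⊑-refl x)) ,
    (λ (y , y⊑x) (z , z⊑x) → let j , y⊑j , z⊑j , least = joins y z in
       (j , ↓-intro (least x (↓-elim y⊑x) (↓-elim z⊑x))) , y⊑j , z⊑j , λ w → least (proj₁ w)) ,
    (λ (y , y⊑x) (z , _) → let m , m⊑y , m⊑z , greatest = meets y z in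
       (m , ↓-intro (⊑-trans m y x m⊑y (↓-elim y⊑x))) , m⊑y , m⊑z , λ w → greatest (proj₁ w))

  Up-lattice : IsFinLattice Up
  Up-lattice =
    (λ u → ⊑-refl (proj₁ u)) , (λ u v p q → subtype-≡ (⊑-antisym _ _ p q)) , (λ u v w → ⊑-trans _ _ _) ,
    enumeration⇒↔Fin (Σ-T-≟ above _≡?_) (enumeration-subtype above elements) , x↑ ,
    (λ (y , x⊑y) (z , _) → let j , y⊑j , z⊑j , least = joins y z in
       (j , ↑-intro (⊑-trans x y j (↑-elim x⊑y) y⊑j)) , y⊑j , z⊑j , λ w → least (proj₁ w)) ,
    (λ (y , x⊑y) (z , x⊑z) → let m , m⊑y , m⊑z , greatest = meets y z in
       (m , ↑-intro (greatest x (↑-elim x⊑y) (↑-elim x⊑z))) , m⊑y , m⊑z , λ w → greatest (proj₁ w))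

  private
    Split = VSum Down Up x↑

    to′ : (y : C) → Dec (y ⊑ x) → Carrier Split
    to′ y (yes y⊑x) = inj₁ (y , ↓-intro y⊑x)
    to′ y (no y⋢x)  = inj₂ ((y , ↑-intro x⊑y) ,
                           T-not-does⁺ (Defs._≟_ Up (y , ↑-intro x⊑y) x↑) λ e → y⋢x (⊑-reflexive (cong proj₁ e)))
      where
      x⊑y : x ⊑ y
      x⊑y with comparable y
      ... | inj₁ y⊑x = ⊥-elim (y⋢x y⊑x)
      ... | inj₂ x⊑y = x⊑y

    to : C → Carrier Split
    to y = to′ y (y ⊑? x)

    from : Carrier Split → C
    from (inj₁ (y , _))     = y
    from (inj₂ ((y , _) , _)) = y

    from-to : ∀ y → from (to y) ≡ y
    from-to y with y ⊑? x
    ... | yes _ = refl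
    ... | no _  = refl

    to′-below : ∀ y (y⊑x : T (below y)) (d : Dec (y ⊑ x)) → to′ y d ≡ inj₁ (y , y⊑x)
    to′-below y _   (yes _)  = cong inj₁ (subtype-≡ refl)
    to′-below y y⊑x (no y⋢x) = ⊥-elim (y⋢x (↓-elim y⊑x))

    to′-above : ∀ y (x⊑y : T (above y)) y≢x (d : Dec (y ⊑ x)) → to′ y d ≡ inj₂ ((y , x⊑y) , y≢x)
    to′-above y x⊑y y≢x (yes y⊑x) =
      ⊥-elim (T-not-does⁻ (Defs._≟_ Up (y , x⊑y) x↑) y≢x (subtype-≡ (⊑-antisym y x y⊑x (↑-elim x⊑y))))
    to′-above y x⊑y y≢x (no _) = cong inj₂ (subtype-≡ (subtype-≡ refl))

    to-from : ∀ s → to (from s) ≡ s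
    to-from (inj₁ (y , y⊑x))         = to′-below y y⊑x (y ⊑? x)
    to-from (inj₂ ((y , x⊑y) , y≢x)) = to′-above y x⊑y y≢x (y ⊑? x)

    to-mono : ∀ y z → y ⊑ z → Defs._≤_ Split (to y) (to z)
    to-mono y z y⊑z with y ⊑? x | z ⊑? x
    ... | yes _   | yes _   = y⊑z
    ... | yes _   | no _    = tt
    ... | no y⋢x  | yes z⊑x = y⋢x (⊑-trans y z x y⊑z z⊑x)
    ... | no _    | no _    = y⊑z

    from-mono : ∀ s s′ → Defs._≤_ Split s s′ → from s ⊑ from s′
    from-mono (inj₁ _)         (inj₁ _)               y⊑z = y⊑z
    from-mono (inj₁ (y , y⊑x)) (inj₂ ((z , x⊑z) , _)) _   = ⊑-trans y x z (↓-elim y⊑x) (↑-elim x⊑z)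
    from-mono (inj₂ _)         (inj₂ _)               y⊑z = y⊑z
    from-mono (inj₂ _)         (inj₁ _)               ()

  ≅-vsum : P ≅ VSum Down Up x↑
  ≅-vsum = ≅-from-monotone-inverses to from to-from from-to to-mono from-mono

comparable⇒¬VI : ∀ P → IsFinLattice P → ∀ x → ∃[ y ] Defs._≤_ P y x × y ≢ x → ∃[ z ] Defs._≤_ P x z × x ≢ z →
                 (∀ y → Defs._≤_ P y x ⊎ Defs._≤_ P x y) → ¬ IsVI P
comparable⇒¬VI P FL x (y , y⊑x , y≢x) (z , x⊑z , x≢z) comparable ¬vsum =
  ¬vsum (Down , Up , x↑ , Down-lattice , Up-lattice ,
         ((x , fromWitness (⊑-refl x)) , (y , fromWitness y⊑x) , λ e → y≢x (sym (cong proj₁ e))) ,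
         (x↑ , (z , fromWitness x⊑z) , λ e → x≢z (cong proj₁ e)) ,
         (λ w → toWitness (proj₂ w)) , ≅-vsum)
  where
  open VerticalCut P FL x comparable
  open FinLattice P FL

nonSingleton-avoid : ∀ {P} → NonSingleton P → ∀ x → ∃[ y ] y ≢ x
nonSingleton-avoid {P} (y , z , y≢z) x with Defs._≟_ P y x
... | yes refl = z , λ e → y≢z (sym e)
... | no y≢x   = y , y≢x

vsum⇒cut : ∀ {P L₁ L₂ b} → IsFinLattice L₁ → NonSingleton L₁ → NonSingleton L₂ → P ≅ VSum L₁ L₂ b →
           Σ (Carrier P) λ e → (∀ s → Defs._≤_ P s e ⊎ Defs._≤_ P e s)
                             × (∃[ y ] Defs._≤_ P y e × y ≢ e) × (∃[ z ] Defs._≤_ P e z × e ≢ z)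
vsum⇒cut {P} {L₁} {L₂} {b} FL₁ ns₁ ns₂ φ = from (inj₁ top) , comparable ,
  (from (inj₁ y) , from-mono (inj₁ y) (inj₁ top) (top-isTop y) , λ e → y≢top (cong proj-L₁ (from-injective e))) ,
  (from w , from-mono (inj₁ top) w tt , λ e → case (from-injective e))
  where
  open Iso φ
  open FinLattice L₁ FL₁ using (top; top-isTop)
  y = proj₁ (nonSingleton-avoid {L₁} ns₁ top)
  y≢top = proj₂ (nonSingleton-avoid {L₁} ns₁ top)
  w : Carrier (VSum L₁ L₂ b)
  w = inj₂ (_ , T-not-does⁺ (Defs._≟_ L₂ _ b) (proj₂ (nonSingleton-avoid {L₂} ns₂ b)))
  proj-L₁ : Carrier (VSum L₁ L₂ b) → Carrier L₁
  proj-L₁ (inj₁ x) = x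
  proj-L₁ (inj₂ _) = top
  case : inj₁ top ≢ w
  case ()
  comparable′ : ∀ s v → to s ≡ v → Defs._≤_ P s (from (inj₁ top)) ⊎ Defs._≤_ P (from (inj₁ top)) s
  comparable′ s (inj₁ x) to-s≡ =
    inj₁ (to-reflects s _ (subst₂ (Defs._≤_ (VSum L₁ L₂ b)) (sym to-s≡) (sym (to-from (inj₁ top))) (top-isTop x)))
  comparable′ s (inj₂ _) to-s≡ =
    inj₂ (to-reflects _ s (subst₂ (Defs._≤_ (VSum L₁ L₂ b)) (sym (to-from (inj₁ top))) (sym to-s≡) tt))
  comparable : ∀ s → Defs._≤_ P s (from (inj₁ top)) ⊎ Defs._≤_ P (from (inj₁ top)) s
  comparable s = comparable′ s (to s) refl

-- The vertical 2-sum

record Summands (L U : Str) : Set where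
  field
    L-lattice    : IsFinLattice L
    U-lattice    : IsFinLattice U
    rankL        : Carrier L → ℕ
    rankL-isRank : IsRank L rankL
    rankU        : Carrier U → ℕ
    rankU-isRank : IsRank U rankU
    t c₁ c₂      : Carrier L
    t-top        : IsTop L t
    coatoms      : TwoCoatoms L c₁ c₂
    3≤rank-L     : 3 ≤ℕ rankL t
    b a₁ a₂ tU   : Carrier U
    b-bot        : IsBot U b
    atoms        : TwoAtoms U a₁ a₂
    tU-top       : IsTop U tU
    3≤rank-U     : 3 ≤ℕ rankU tU

withAtoms : ∀ {L U} (D : Summands L U) (a₁′ a₂′ : Carrier U) → TwoAtoms U a₁′ a₂′ → Summands L U
withAtoms D a₁′ a₂′ atoms′ = record D { a₁ = a₁′ ; a₂ = a₂′ ; atoms = atoms′ }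

module TwoSum {L U : Str} (D : Summands L U) where
  open Summands D public
  module L′ = Ranked L L-lattice rankL rankL-isRank
  module U′ = Ranked U U-lattice rankU rankU-isRank
  open L′ using () renaming (_⊑_ to _⊑L_)
  open U′ using () renaming (_⊑_ to _⊑U_)

  S : Str
  S = V2Sum L U t c₁ c₂ b a₁ a₂

  _≼_ : Carrier S → Carrier S → Set
  _≼_ = Defs._≤_ S

  -- The same predicates as in V2Sum, so that Lower ⊎ Upper is definitionally Carrier S.
  isLower : Carrier L → Bool
  isLower x = not (does (Defs._≟_ L x t))

  isUpper : Carrier U → Bool
  isUpper u = not (does (Defs._≟_ U u b) ∨ does (Defs._≟_ U u a₁) ∨ does (Defs._≟_ U u a₂))

  Lower Upper : Set
  Lower = Σ (Carrier L) λ x → T (isLower x)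
  Upper = Σ (Carrier U) λ u → T (isUpper u)

  lower-intro : ∀ {x} → x ≢ t → T (isLower x)
  lower-intro {x} = T-not-does⁺ (Defs._≟_ L x t)

  lower-elim : ∀ {x} → T (isLower x) → x ≢ t
  lower-elim {x} = T-not-does⁻ (Defs._≟_ L x t)

  data UpperView (u : Carrier U) : Set where
    is-b  : u ≡ b → UpperView u
    is-a₁ : u ≡ a₁ → UpperView u
    is-a₂ : u ≡ a₂ → UpperView u
    upper : T (isUpper u) → UpperView u

  upper-intro : ∀ {u} → u ≢ b → u ≢ a₁ → u ≢ a₂ → T (isUpper u)
  upper-intro {u} u≢b u≢a₁ u≢a₂
    with Defs._≟_ U u b | Defs._≟_ U u a₁ | Defs._≟_ U u a₂
  ... | yes e | _     | _     = u≢b e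
  ... | no _  | yes e | _     = u≢a₁ e
  ... | no _  | no _  | yes e = u≢a₂ e
  ... | no _  | no _  | no _  = tt

  upper-elim : ∀ {u} → T (isUpper u) → (u ≢ b) × (u ≢ a₁) × (u ≢ a₂)
  upper-elim {u} p with Defs._≟_ U u b | Defs._≟_ U u a₁ | Defs._≟_ U u a₂
  upper-elim () | yes _ | _     | _
  upper-elim () | no _  | yes _ | _
  upper-elim () | no _  | no _  | yes _
  ... | no u≢b | no u≢a₁ | no u≢a₂ = u≢b , u≢a₁ , u≢a₂

  upperView : ∀ u → UpperView u
  upperView u with Defs._≟_ U u b | Defs._≟_ U u a₁ | Defs._≟_ U u a₂
  ... | yes e   | _       | _       = is-b e
  ... | no _    | yes e   | _       = is-a₁ e
  ... | no _    | no _    | yes e   = is-a₂ e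
  ... | no u≢b  | no u≢a₁ | no u≢a₂ = upper (upper-intro u≢b u≢a₁ u≢a₂)

  c₁≢t : c₁ ≢ t
  c₁≢t = L′.coatom≢top t-top (proj₁ coatoms)
  c₂≢t : c₂ ≢ t
  c₂≢t = L′.coatom≢top t-top (proj₁ (proj₂ coatoms))
  c₁⋢c₂ : ¬ (c₁ ⊑L c₂)
  c₁⋢c₂ = L′.coatoms-incomparable t-top coatoms
  c₂⋢c₁ : ¬ (c₂ ⊑L c₁)
  c₂⋢c₁ = L′.coatoms-incomparable t-top (exactPair-swap coatoms)

  a₁≢b : a₁ ≢ b
  a₁≢b = U′.atom≢bot b-bot (proj₁ atoms)
  a₂≢b : a₂ ≢ b
  a₂≢b = U′.atom≢bot b-bot (proj₁ (proj₂ atoms))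
  a₁⋢a₂ : ¬ (a₁ ⊑U a₂)
  a₁⋢a₂ = U′.atoms-incomparable b-bot (exactPair-swap atoms)
  a₂⋢a₁ : ¬ (a₂ ⊑U a₁)
  a₂⋢a₁ = U′.atoms-incomparable b-bot atoms

  below-b : ∀ {w} → w ⊑U b → w ≡ b
  below-b {w} w⊑b = U′.⊑-antisym w b w⊑b (b-bot w)

  below-t : ∀ {x y} → x ⊑L y → y ≢ t → x ≢ t
  below-t {y = y} x⊑y y≢t refl = y≢t (L′.⊑-antisym y t (t-top y) x⊑y)

  below-coatom : ∀ {x} → x ≢ t → (x ⊑L c₁) ⊎ (x ⊑L c₂)
  below-coatom = L′.below-coatoms t-top coatoms

  above-atom-upper : ∀ {u} → T (isUpper u) → (a₁ ⊑U u) ⊎ (a₂ ⊑U u)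
  above-atom-upper p = U′.above-atoms b-bot atoms (proj₁ (upper-elim p))

  upper-not-below-atom : ∀ {u a} → T (isUpper u) → IsAtom U a → ¬ (u ⊑U a)
  upper-not-below-atom p a-atom u⊑a with upper-elim p | U′.below-atom b-bot a-atom u⊑a
  ... | u≢b , u≢a₁ , u≢a₂ | inj₂ u≡b = u≢b u≡b
  ... | u≢b , u≢a₁ , u≢a₂ | inj₁ refl with proj₂ (proj₂ (proj₂ atoms)) _ a-atom
  ...   | inj₁ e = u≢a₁ e
  ...   | inj₂ e = u≢a₂ e

  c₁↓ c₂↓ : Lower
  c₁↓ = c₁ , lower-intro c₁≢t
  c₂↓ = c₂ , lower-intro c₂≢t

  upper-rank≥2 : ∀ {u} → T (isUpper u) → 2 ≤ℕ rankU u
  upper-rank≥2 {u} p with upper-elim p | rankU u in ru≡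
  ... | u≢b , _ , _ | zero = ⊥-elim (u≢b (U′.rank≡0⇒bot b-bot ru≡))
  ... | _ , u≢a₁ , u≢a₂ | suc zero with proj₂ (proj₂ (proj₂ atoms)) u (U′.rank≡1⇒atom ru≡)
  ...   | inj₁ e = ⊥-elim (u≢a₁ e)
  ...   | inj₂ e = ⊥-elim (u≢a₂ e)
  upper-rank≥2 p | _ | suc (suc _) = s≤s (s≤s z≤n)

  tU-upper : T (isUpper tU)
  tU-upper = upper-intro (rank≢ (U′.rank-bot b-bot) λ ()) (rank≢ (U′.rank-atom (proj₁ atoms)) λ { (s≤s ()) })
                         (rank≢ (U′.rank-atom (proj₁ (proj₂ atoms))) λ { (s≤s ()) })
    where
    rank≢ : ∀ {u k} → rankU u ≡ k → ¬ (3 ≤ℕ k) → tU ≢ u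
    rank≢ ru≡k 3≰k refl = 3≰k (subst (3 ≤ℕ_) ru≡k 3≤rank-U)

  ≼-refl : ∀ s → s ≼ s
  ≼-refl (inj₁ (x , _)) = L′.⊑-refl x
  ≼-refl (inj₂ (u , _)) = U′.⊑-refl u

  ≼-antisym : ∀ s s′ → s ≼ s′ → s′ ≼ s → s ≡ s′
  ≼-antisym (inj₁ (x , _)) (inj₁ (y , _)) p q = cong inj₁ (subtype-≡ (L′.⊑-antisym x y p q))
  ≼-antisym (inj₂ (u , _)) (inj₂ (v , _)) p q = cong inj₂ (subtype-≡ (U′.⊑-antisym u v p q))
  ≼-antisym (inj₁ _) (inj₂ _) _ ()

  ≼-trans : ∀ s s′ s″ → s ≼ s′ → s′ ≼ s″ → s ≼ s″
  ≼-trans (inj₁ (x , _)) (inj₁ (y , _)) (inj₁ (z , _)) p q = L′.⊑-trans x y z p q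
  ≼-trans (inj₁ (x , _)) (inj₁ (y , _)) (inj₂ _) p (inj₁ (y⊑c₁ , r)) = inj₁ (L′.⊑-trans x y c₁ p y⊑c₁ , r)
  ≼-trans (inj₁ (x , _)) (inj₁ (y , _)) (inj₂ _) p (inj₂ (y⊑c₂ , r)) = inj₂ (L′.⊑-trans x y c₂ p y⊑c₂ , r)
  ≼-trans (inj₁ _) (inj₂ (v , _)) (inj₂ (w , _)) (inj₁ (p , a₁⊑v)) q = inj₁ (p , U′.⊑-trans a₁ v w a₁⊑v q)
  ≼-trans (inj₁ _) (inj₂ (v , _)) (inj₂ (w , _)) (inj₂ (p , a₂⊑v)) q = inj₂ (p , U′.⊑-trans a₂ v w a₂⊑v q)
  ≼-trans (inj₂ (u , _)) (inj₂ (v , _)) (inj₂ (w , _)) p q = U′.⊑-trans u v w p q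
  ≼-trans (inj₁ _) (inj₂ _) (inj₁ _) _ ()
  ≼-trans (inj₂ _) (inj₂ _) (inj₁ _) _ ()

  _≼?_ : ∀ s s′ → Dec (s ≼ s′)
  inj₁ (x , _) ≼? inj₁ (y , _) = x L′.⊑? y
  inj₁ (x , _) ≼? inj₂ (v , _) = (x L′.⊑? c₁ ×-dec a₁ U′.⊑? v) ⊎-dec (x L′.⊑? c₂ ×-dec a₂ U′.⊑? v)
  inj₂ _       ≼? inj₁ _       = no λ ()
  inj₂ (u , _) ≼? inj₂ (v , _) = u U′.⊑? v

  elements : Enumeration (Carrier S)
  elements = enumeration-⊎ (enumeration-subtype isLower L′.elements) (enumeration-subtype isUpper U′.elements)

  top : Carrier S
  top = inj₂ (tU , tU-upper)

  top-isTop : IsTop S top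
  top-isTop (inj₁ (x , p)) with below-coatom (lower-elim p)
  ... | inj₁ x⊑c₁ = inj₁ (x⊑c₁ , tU-top a₁)
  ... | inj₂ x⊑c₂ = inj₂ (x⊑c₂ , tU-top a₂)
  top-isTop (inj₂ (u , _)) = tU-top u

  Meet : Carrier S → Carrier S → Set
  Meet s s′ = ∃[ m ] IsGLB S s s′ m

  meet-lower-lower : ∀ x y → Meet (inj₁ x) (inj₁ y)
  meet-lower-lower (x , p) (y , _) with L′.meets x y
  ... | m , m⊑x , m⊑y , greatest = inj₁ (m , lower-intro (below-t m⊑x (lower-elim p))) , m⊑x , m⊑y , λ where
      (inj₁ (z , _)) → greatest z
      (inj₂ _) ()

  meet-lower-upper : ∀ x v → Meet (inj₁ x) (inj₂ v)
  meet-lower-upper (x , p) (v , q) with a₁ U′.⊑? v | a₂ U′.⊑? v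
  ... | yes a₁⊑v | yes a₂⊑v = inj₁ (x , p) , L′.⊑-refl x , x≼v (below-coatom (lower-elim p)) , λ where
      (inj₁ _) z⊑x _ → z⊑x
      (inj₂ _) ()
    where
    x≼v : (x ⊑L c₁) ⊎ (x ⊑L c₂) → inj₁ (x , p) ≼ inj₂ (v , q)
    x≼v (inj₁ x⊑c₁) = inj₁ (x⊑c₁ , a₁⊑v)
    x≼v (inj₂ x⊑c₂) = inj₂ (x⊑c₂ , a₂⊑v)
  ... | yes a₁⊑v | no a₂⋢v with L′.meets x c₁
  ...   | m , m⊑x , m⊑c₁ , greatest = inj₁ (m , lower-intro (below-t m⊑c₁ c₁≢t)) , m⊑x , inj₁ (m⊑c₁ , a₁⊑v) , λ where
      (inj₁ (z , _)) z⊑x (inj₁ (z⊑c₁ , _)) → greatest z z⊑x z⊑c₁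
      (inj₁ _) _ (inj₂ (_ , a₂⊑v)) → ⊥-elim (a₂⋢v a₂⊑v)
      (inj₂ _) ()
  meet-lower-upper (x , p) (v , q) | no a₁⋢v | yes a₂⊑v with L′.meets x c₂
  ...   | m , m⊑x , m⊑c₂ , greatest = inj₁ (m , lower-intro (below-t m⊑c₂ c₂≢t)) , m⊑x , inj₂ (m⊑c₂ , a₂⊑v) , λ where
      (inj₁ (z , _)) z⊑x (inj₂ (z⊑c₂ , _)) → greatest z z⊑x z⊑c₂
      (inj₁ _) _ (inj₁ (_ , a₁⊑v)) → ⊥-elim (a₁⋢v a₁⊑v)
      (inj₂ _) ()
  meet-lower-upper (x , p) (v , q) | no a₁⋢v | no a₂⋢v with above-atom-upper q
  ... | inj₁ a₁⊑v = ⊥-elim (a₁⋢v a₁⊑v)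
  ... | inj₂ a₂⊑v = ⊥-elim (a₂⋢v a₂⊑v)

  private
    meet-at-upper : ∀ u v {m} (r : T (isUpper m)) → IsGLB U (proj₁ u) (proj₁ v) m → Meet (inj₂ u) (inj₂ v)
    meet-at-upper _ _ {m} r (m⊑u , m⊑v , greatest) = inj₂ (m , r) , m⊑u , m⊑v , λ where
        (inj₂ (w , _)) w⊑u w⊑v → greatest w w⊑u w⊑v
        (inj₁ _) (inj₁ (z⊑c₁ , a₁⊑u)) (inj₁ (_ , a₁⊑v)) → inj₁ (z⊑c₁ , greatest a₁ a₁⊑u a₁⊑v)
        (inj₁ _) (inj₂ (z⊑c₂ , a₂⊑u)) (inj₂ (_ , a₂⊑v)) → inj₂ (z⊑c₂ , greatest a₂ a₂⊑u a₂⊑v)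
        (inj₁ z) (inj₁ (z⊑c₁ , _)) (inj₂ (z⊑c₂ , _)) → mixed {z} z⊑c₁ z⊑c₂
        (inj₁ z) (inj₂ (z⊑c₂ , _)) (inj₁ (z⊑c₁ , _)) → mixed {z} z⊑c₁ z⊑c₂
      where
      mixed : ∀ {z : Lower} → proj₁ z ⊑L c₁ → proj₁ z ⊑L c₂ → inj₁ z ≼ inj₂ (m , r)
      mixed z⊑c₁ z⊑c₂ with above-atom-upper r
      ... | inj₁ a₁⊑m = inj₁ (z⊑c₁ , a₁⊑m)
      ... | inj₂ a₂⊑m = inj₂ (z⊑c₂ , a₂⊑m)

    meet-at-b : ∀ u v → IsGLB U (proj₁ u) (proj₁ v) b → Meet (inj₂ u) (inj₂ v)
    meet-at-b u v (_ , _ , greatest) with L′.meets c₁ c₂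
    ... | m , m⊑c₁ , m⊑c₂ , greatest′ = inj₁ m↓ , m≼ u , m≼ v , λ where
        (inj₂ (w , r)) w⊑u w⊑v → ⊥-elim (proj₁ (upper-elim r) (below-b (greatest w w⊑u w⊑v)))
        (inj₁ _) (inj₁ (_ , a₁⊑u)) (inj₁ (_ , a₁⊑v)) → ⊥-elim (a₁≢b (below-b (greatest a₁ a₁⊑u a₁⊑v)))
        (inj₁ _) (inj₂ (_ , a₂⊑u)) (inj₂ (_ , a₂⊑v)) → ⊥-elim (a₂≢b (below-b (greatest a₂ a₂⊑u a₂⊑v)))
        (inj₁ (z , _)) (inj₁ (z⊑c₁ , _)) (inj₂ (z⊑c₂ , _)) → greatest′ z z⊑c₁ z⊑c₂
        (inj₁ (z , _)) (inj₂ (z⊑c₂ , _)) (inj₁ (z⊑c₁ , _)) → greatest′ z z⊑c₁ z⊑c₂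
      where
      m↓ : Lower
      m↓ = m , lower-intro (below-t m⊑c₁ c₁≢t)
      m≼ : ∀ w → inj₁ m↓ ≼ inj₂ w
      m≼ (w , r) with above-atom-upper r
      ... | inj₁ a₁⊑w = inj₁ (m⊑c₁ , a₁⊑w)
      ... | inj₂ a₂⊑w = inj₂ (m⊑c₂ , a₂⊑w)

    meet-at-a₁ : ∀ u v → IsGLB U (proj₁ u) (proj₁ v) a₁ → Meet (inj₂ u) (inj₂ v)
    meet-at-a₁ u v (a₁⊑u , a₁⊑v , greatest) = inj₁ c₁↓ , inj₁ (L′.⊑-refl c₁ , a₁⊑u) , inj₁ (L′.⊑-refl c₁ , a₁⊑v) , λ where
        (inj₂ (w , r)) w⊑u w⊑v → ⊥-elim (upper-not-below-atom r (proj₁ atoms) (greatest w w⊑u w⊑v))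
        (inj₁ _) (inj₁ (z⊑c₁ , _)) _ → z⊑c₁
        (inj₁ _) (inj₂ _) (inj₁ (z⊑c₁ , _)) → z⊑c₁
        (inj₁ _) (inj₂ (_ , a₂⊑u)) (inj₂ (_ , a₂⊑v)) → ⊥-elim (a₂⋢a₁ (greatest a₂ a₂⊑u a₂⊑v))

    meet-at-a₂ : ∀ u v → IsGLB U (proj₁ u) (proj₁ v) a₂ → Meet (inj₂ u) (inj₂ v)
    meet-at-a₂ u v (a₂⊑u , a₂⊑v , greatest) = inj₁ c₂↓ , inj₂ (L′.⊑-refl c₂ , a₂⊑u) , inj₂ (L′.⊑-refl c₂ , a₂⊑v) , λ where
        (inj₂ (w , r)) w⊑u w⊑v → ⊥-elim (upper-not-below-atom r (proj₁ (proj₂ atoms)) (greatest w w⊑u w⊑v))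
        (inj₁ _) (inj₂ (z⊑c₂ , _)) _ → z⊑c₂
        (inj₁ _) (inj₁ _) (inj₂ (z⊑c₂ , _)) → z⊑c₂
        (inj₁ _) (inj₁ (_ , a₁⊑u)) (inj₁ (_ , a₁⊑v)) → ⊥-elim (a₁⋢a₂ (greatest a₁ a₁⊑u a₁⊑v))

  meet-upper-upper : ∀ u v → Meet (inj₂ u) (inj₂ v)
  meet-upper-upper u v with U′.meets (proj₁ u) (proj₁ v)
  ... | m , glb with upperView m
  ... | upper r    = meet-at-upper u v r glb
  ... | is-b refl  = meet-at-b u v glb
  ... | is-a₁ refl = meet-at-a₁ u v glb
  ... | is-a₂ refl = meet-at-a₂ u v glb

  meets : ∀ s s′ → Meet s s′
  meets (inj₁ x) (inj₁ y) = meet-lower-lower x y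
  meets (inj₁ x) (inj₂ v) = meet-lower-upper x v
  meets (inj₂ v) (inj₁ x) = let m , m≼x , m≼v , greatest = meet-lower-upper x v in
                            m , m≼v , m≼x , λ z z≼v z≼x → greatest z z≼x z≼v
  meets (inj₂ u) (inj₂ v) = meet-upper-upper u v

  S-lattice : IsFinLattice S
  S-lattice = ≼-refl , ≼-antisym , ≼-trans , enumeration⇒↔Fin (Defs._≟_ S) elements , top ,
              joins-from-meets S ≼-trans _≼?_ elements top top-isTop meets , meets

  retractL : Carrier S → Carrier L
  retractL (inj₁ (x , _)) = x
  retractL (inj₂ _)       = t

  retractU : Carrier S → Carrier U
  retractU (inj₂ (u , _)) = u
  retractU (inj₁ (x , _)) with x L′.≡? c₁ | x L′.≡? c₂
  ... | yes _ | _     = a₁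
  ... | no _  | yes _ = a₂
  ... | no _  | no _  = b

  rank-c₂≡c₁ : rankL c₂ ≡ rankL c₁
  rank-c₂≡c₁ = suc-injective (trans (sym (L′.rank-coatom t-top (proj₁ (proj₂ coatoms))))
                                     (L′.rank-coatom t-top (proj₁ coatoms)))

  lower-rank≤ : ∀ {x} → x ≢ t → rankL x ≤ℕ rankL c₁
  lower-rank≤ {x} x≢t with below-coatom x≢t
  ... | inj₁ x⊑c₁ = L′.rank-mono _ c₁ x⊑c₁
  ... | inj₂ x⊑c₂ = subst (rankL x ≤ℕ_) rank-c₂≡c₁ (L′.rank-mono x c₂ x⊑c₂)

  strictly-above-atom⇒upper : ∀ {a z} → IsAtom U a → a ⊑U z → z ≢ a → T (isUpper z)
  strictly-above-atom⇒upper {a} {z} a-atom a⊑z z≢a = upper-intro z≢b (z≢atom (proj₁ atoms)) (z≢atom (proj₁ (proj₂ atoms)))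
    where
    z≢b : z ≢ b
    z≢b refl = U′.atom≢bot b-bot a-atom (below-b a⊑z)
    z≢atom : ∀ {a′} → IsAtom U a′ → z ≢ a′
    z≢atom a′-atom refl with U′.below-atom b-bot a′-atom a⊑z
    ... | inj₁ a≡z = z≢a (sym a≡z)
    ... | inj₂ a≡b = U′.atom≢bot b-bot a-atom a≡b

  covers-lower : ∀ {x y : Lower} → Covers S (inj₁ x) (inj₁ y) → Covers L (proj₁ x) (proj₁ y)
  covers-lower {x , _} {y , q} (x⊑y , x≢y , between) = x⊑y , (λ e → x≢y (cong inj₁ (subtype-≡ e))) , between′
    where
    between′ : ∀ z → x ⊑L z → z ⊑L y → (z ≡ x) ⊎ (z ≡ y)
    between′ z x⊑z z⊑y = Sum.map (cong retractL) (cong retractL)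
                           (between (inj₁ (z , lower-intro (below-t z⊑y (lower-elim q)))) x⊑z z⊑y)

  covers-upper : ∀ {u v : Upper} → Covers S (inj₂ u) (inj₂ v) → Covers U (proj₁ u) (proj₁ v)
  covers-upper {u , p} {v , _} (u⊑v , u≢v , between) = u⊑v , (λ e → u≢v (cong inj₂ (subtype-≡ e))) , between′
    where
    between′ : ∀ z → u ⊑U z → z ⊑U v → (z ≡ u) ⊎ (z ≡ v)
    between′ z u⊑z z⊑v with upperView z
    ... | is-b refl  = ⊥-elim (proj₁ (upper-elim p) (below-b u⊑z))
    ... | is-a₁ refl = ⊥-elim (upper-not-below-atom p (proj₁ atoms) u⊑z)
    ... | is-a₂ refl = ⊥-elim (upper-not-below-atom p (proj₁ (proj₂ atoms)) u⊑z)
    ... | upper r    = Sum.map (cong retractU) (cong retractU) (between (inj₂ (z , r)) u⊑z z⊑v)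

  private
    covers-across-at : ∀ {x v} (c : Lower) {a} → IsAtom U a → (∀ w → a ⊑U proj₁ w → inj₁ c ≼ inj₂ w) →
                       Covers S (inj₁ x) (inj₂ v) → proj₁ x ⊑L proj₁ c → a ⊑U proj₁ v →
                       (proj₁ x ≡ proj₁ c) × Covers U a (proj₁ v)
    covers-across-at {x} {v , q} c {a} a-atom link (_ , _ , between) x⊑c a⊑v with between (inj₁ c) x⊑c (link (v , q) a⊑v)
    ... | inj₂ ()
    ... | inj₁ c≡x = sym (cong retractL c≡x) , a⊑v , a≢v , between′
      where
      a≢v : a ≢ v
      a≢v refl = upper-not-below-atom q a-atom (U′.⊑-refl a)
      between′ : ∀ z → a ⊑U z → z ⊑U v → (z ≡ a) ⊎ (z ≡ v)
      between′ z a⊑z z⊑v with z U′.≡? a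
      ... | yes z≡a = inj₁ z≡a
      ... | no z≢a with strictly-above-atom⇒upper a-atom a⊑z z≢a
      ...   | z-upper
        with between (inj₂ (z , z-upper)) (≼-trans (inj₁ x) (inj₁ c) (inj₂ (z , z-upper)) x⊑c (link (z , z-upper) a⊑z)) z⊑v
      ...   | inj₁ ()
      ...   | inj₂ e = inj₂ (cong retractU e)

  covers-across : ∀ {x v} → Covers S (inj₁ x) (inj₂ v) → (rankL (proj₁ x) ≡ rankL c₁) × (rankU (proj₁ v) ≡ 2)
  covers-across x⋖v@(inj₁ (x⊑c₁ , a₁⊑v) , _) =
    let x≡c₁ , a₁⋖v = covers-across-at c₁↓ (proj₁ atoms) (λ _ a₁⊑w → inj₁ (L′.⊑-refl c₁ , a₁⊑w)) x⋖v x⊑c₁ a₁⊑v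
    in cong rankL x≡c₁ , trans (U′.rank-covers a₁⋖v) (cong suc (U′.rank-atom (proj₁ atoms)))
  covers-across x⋖v@(inj₂ (x⊑c₂ , a₂⊑v) , _) =
    let x≡c₂ , a₂⋖v = covers-across-at c₂↓ (proj₁ (proj₂ atoms)) (λ _ a₂⊑w → inj₂ (L′.⊑-refl c₂ , a₂⊑w)) x⋖v x⊑c₂ a₂⊑v
    in trans (cong rankL x≡c₂) rank-c₂≡c₁ , trans (U′.rank-covers a₂⋖v) (cong suc (U′.rank-atom (proj₁ (proj₂ atoms))))

  -- The atoms of U are merged with c₁, c₂, so ranks in the upper part are shifted by rankL c₁ − 1.
  rank : Carrier S → ℕ
  rank (inj₁ (x , _)) = rankL x
  rank (inj₂ (u , _)) = suc (rankL c₁) + (rankU u ∸ 2)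

  rank-isRank : IsRank S rank
  rank-isRank = rank-bot , rank-covers
    where
    open ≡-Reasoning
    rank-bot : ∀ s → IsBot S s → rank s ≡ 0
    rank-bot (inj₁ (x , _)) s-bot = L′.rank-bot x-bot
      where
      x-bot : IsBot L x
      x-bot y with y L′.≡? t
      ... | yes refl = t-top x
      ... | no y≢t   = s-bot (inj₁ (y , lower-intro y≢t))
    rank-bot (inj₂ _) s-bot = ⊥-elim (s-bot (inj₁ c₁↓))
    rank-covers : ∀ s s′ → Covers S s s′ → rank s′ ≡ suc (rank s)
    rank-covers (inj₁ _) (inj₁ _) x⋖y = L′.rank-covers (covers-lower x⋖y)
    rank-covers (inj₁ (x , _)) (inj₂ (v , _)) x⋖v = let rx≡ , rv≡2 = covers-across x⋖v in begin
      suc (rankL c₁) + (rankU v ∸ 2) ≡⟨ cong (λ k → suc (rankL c₁) + (k ∸ 2)) rv≡2 ⟩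
      suc (rankL c₁) + 0             ≡⟨ +-identityʳ _ ⟩
      suc (rankL c₁)                 ≡⟨ cong suc (sym rx≡) ⟩
      suc (rankL x)                  ∎
    rank-covers (inj₂ (u , p)) (inj₂ (v , _)) u⋖v = begin
      suc (rankL c₁) + (rankU v ∸ 2)         ≡⟨ cong (λ k → suc (rankL c₁) + (k ∸ 2)) (U′.rank-covers (covers-upper u⋖v)) ⟩
      suc (rankL c₁) + (suc (rankU u) ∸ 2)   ≡⟨ cong (suc (rankL c₁) +_) (+-∸-assoc 1 (upper-rank≥2 p)) ⟩
      suc (rankL c₁) + suc (rankU u ∸ 2)     ≡⟨ +-suc (suc (rankL c₁)) (rankU u ∸ 2) ⟩
      suc (suc (rankL c₁) + (rankU u ∸ 2))   ∎
    rank-covers (inj₂ _) (inj₁ _) (() , _)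

  top-unique : ∀ {t′} → IsTop S t′ → t′ ≡ top
  top-unique {t′} t′-top = ≼-antisym t′ top (top-isTop t′) (t′-top top)

  coatom-upper : ∀ {s} → IsCoatom S s → Σ Upper λ u → (s ≡ inj₂ u) × IsCoatom U (proj₁ u)
  coatom-upper (t′ , t′-top , s⋖t′) with top-unique t′-top
  coatom-upper {inj₁ _} (_ , _ , x⋖top) | refl = ⊥-elim (3≰2 (subst (3 ≤ℕ_) (proj₂ (covers-across x⋖top)) 3≤rank-U))
    where
    3≰2 : ¬ (3 ≤ℕ 2)
    3≰2 (s≤s (s≤s ()))
  coatom-upper {inj₂ u} (_ , _ , u⋖top) | refl = u , refl , tU , tU-top , covers-upper u⋖top

  coatom⇒upper : ∀ {u} → IsCoatom U u → T (isUpper u)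
  coatom⇒upper {u} u-coatom = upper-intro (rank≢ (U′.rank-bot b-bot) λ { (s≤s ()) })
                                          (rank≢ (U′.rank-atom (proj₁ atoms)) λ { (s≤s (s≤s ())) })
                                          (rank≢ (U′.rank-atom (proj₁ (proj₂ atoms))) λ { (s≤s (s≤s ())) })
    where
    rank≢ : ∀ {w k} → rankU w ≡ k → ¬ (3 ≤ℕ suc k) → u ≢ w
    rank≢ rw≡k 3≰ refl = 3≰ (subst (λ n → 3 ≤ℕ suc n) rw≡k (subst (3 ≤ℕ_) (U′.rank-coatom tU-top u-coatom) 3≤rank-U))

  coatom-lift : ∀ {u} (p : T (isUpper u)) → IsCoatom U u → IsCoatom S (inj₂ (u , p))
  coatom-lift {u} p (t′ , t′-top , u⋖t′) with U′.top-unique t′-top tU-top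
  ... | refl = top , top-isTop , proj₁ u⋖t′ , (λ e → proj₁ (proj₂ u⋖t′) (cong retractU e)) , between
    where
    between : ∀ z → inj₂ (u , p) ≼ z → z ≼ top → (z ≡ inj₂ (u , p)) ⊎ (z ≡ top)
    between (inj₂ (w , _)) u⊑w w⊑tU =
      Sum.map (λ e → cong inj₂ (subtype-≡ e)) (λ e → cong inj₂ (subtype-≡ e)) (proj₂ (proj₂ u⋖t′) w u⊑w w⊑tU)

  coatom↑ : ∀ {u} → IsCoatom U u → Carrier S
  coatom↑ u-coatom = inj₂ (_ , coatom⇒upper u-coatom)

  twoCoatoms-lift : ∀ {e₁ e₂} (pair : TwoCoatoms U e₁ e₂) →
                    TwoCoatoms S (coatom↑ (proj₁ pair)) (coatom↑ (proj₁ (proj₂ pair)))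
  twoCoatoms-lift (e₁-coatom , e₂-coatom , e₁≢e₂ , only) =
    coatom-lift _ e₁-coatom , coatom-lift _ e₂-coatom , (λ e → e₁≢e₂ (cong retractU e)) , only′
    where
    only′ : ∀ s → IsCoatom S s → (s ≡ coatom↑ e₁-coatom) ⊎ (s ≡ coatom↑ e₂-coatom)
    only′ s s-coatom with coatom-upper s-coatom
    ... | (u , _) , refl , u-coatom =
      Sum.map (λ { refl → cong inj₂ (subtype-≡ refl) }) (λ { refl → cong inj₂ (subtype-≡ refl) }) (only u u-coatom)

  C≥3-lift : C≥3 U → C≥3 S
  C≥3-lift (x , y , z , x-coatom , y-coatom , z-coatom , x≢y , x≢z , y≢z) =
    coatom↑ x-coatom , coatom↑ y-coatom , coatom↑ z-coatom ,
    coatom-lift _ x-coatom , coatom-lift _ y-coatom , coatom-lift _ z-coatom ,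
    (λ e → x≢y (cong retractU e)) , (λ e → x≢z (cong retractU e)) , (λ e → y≢z (cong retractU e))

  neck-level : ∀ z → rank z ≡ rankL c₁ → (z ≡ inj₁ c₁↓) ⊎ (z ≡ inj₁ c₂↓)
  neck-level (inj₂ _) e = ⊥-elim (<-irrefl (sym e) (s≤s (m≤m+n (rankL c₁) _)))
  neck-level (inj₁ (x , p)) e with below-coatom (lower-elim p)
  ... | inj₁ x⊑c₁ with x L′.≡? c₁
  ...   | yes refl = inj₁ (cong inj₁ (subtype-≡ refl))
  ...   | no x≢c₁  = ⊥-elim (<-irrefl e (L′.rank-strict x c₁ x⊑c₁ x≢c₁))
  neck-level (inj₁ (x , p)) e | inj₂ x⊑c₂ with x L′.≡? c₂
  ...   | yes refl = inj₂ (cong inj₁ (subtype-≡ refl))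
  ...   | no x≢c₂  = ⊥-elim (<-irrefl (trans e (sym rank-c₂≡c₁)) (L′.rank-strict x c₂ x⊑c₂ x≢c₂))

  neck : HasNeck S
  neck = rank , rank-isRank , top , top-isTop , rankL c₁ , k≢1 , k≢rank-top∸1 ,
         inj₁ c₁↓ , inj₁ c₂↓ , (λ e → proj₁ (proj₂ (proj₂ coatoms)) (cong retractL e)) , refl , rank-c₂≡c₁ , neck-level
    where
    k≢1 : rankL c₁ ≢ 1
    k≢1 e with subst (3 ≤ℕ_) (L′.rank-coatom t-top (proj₁ coatoms)) 3≤rank-L
    ... | s≤s 2≤rc₁ with subst (2 ≤ℕ_) e 2≤rc₁
    ...   | s≤s ()
    k≢rank-top∸1 : rankL c₁ ≢ rankL c₁ + (rankU tU ∸ 2)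
    k≢rank-top∸1 = <⇒≢ (m<m+n (rankL c₁) (m<n⇒0<n∸m 3≤rank-U))

  isVI : IsVI L → IsVI U → IsVI S
  isVI L-vi U-vi (_ , _ , _ , FL₁ , _ , ns₁ , ns₂ , _ , φ) with vsum⇒cut FL₁ ns₁ ns₂ φ
  ... | inj₁ (x , p) , comparable , (inj₁ (y , _) , y⊑x , y≢x) , _ =
    comparable⇒¬VI L L-lattice x (y , y⊑x , λ e → y≢x (cong inj₁ (subtype-≡ e))) (t , t-top x , lower-elim p)
                   comparable-x L-vi
    where
    comparable-x : ∀ y → (y ⊑L x) ⊎ (x ⊑L y)
    comparable-x y with y L′.≡? t
    ... | yes refl = inj₂ (t-top x)
    ... | no y≢t   = comparable (inj₁ (y , lower-intro y≢t))
  ... | inj₂ (u , q) , comparable , _ , (inj₂ (w , _) , u⊑w , u≢w) =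
    comparable⇒¬VI U U-lattice u (b , b-bot u , λ { refl → proj₁ (upper-elim q) refl })
                   (w , u⊑w , λ e → u≢w (cong inj₂ (subtype-≡ e))) comparable-u U-vi
    where
    comparable-u : ∀ y → (y ⊑U u) ⊎ (u ⊑U y)
    comparable-u y with upperView y
    ... | is-b refl = inj₁ (b-bot u)
    ... | is-a₁ refl with comparable (inj₁ c₁↓)
    ...   | inj₁ (inj₁ (_ , a₁⊑u)) = inj₁ a₁⊑u
    ...   | inj₁ (inj₂ (c₁⊑c₂ , _)) = ⊥-elim (c₁⋢c₂ c₁⊑c₂)
    comparable-u y | is-a₂ refl with comparable (inj₁ c₂↓)
    ...   | inj₁ (inj₂ (_ , a₂⊑u)) = inj₁ a₂⊑u
    ...   | inj₁ (inj₁ (c₂⊑c₁ , _)) = ⊥-elim (c₂⋢c₁ c₂⊑c₁)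
    comparable-u y | upper r = comparable (inj₂ (y , r))

  isComposition : IsVI L → IsVI U → IsComposition S
  isComposition L-vi U-vi = (S-lattice , (rank , rank-isRank) , isVI L-vi U-vi) , neck

  retractU-c₁ : ∀ p → retractU (inj₁ (c₁ , p)) ≡ a₁
  retractU-c₁ _ with c₁ L′.≡? c₁
  ... | yes _    = refl
  ... | no c₁≢c₁ = ⊥-elim (c₁≢c₁ refl)

  retractU-c₂ : ∀ p → retractU (inj₁ (c₂ , p)) ≡ a₂
  retractU-c₂ _ with c₂ L′.≡? c₁ | c₂ L′.≡? c₂
  ... | yes c₂≡c₁ | _     = ⊥-elim (proj₁ (proj₂ (proj₂ coatoms)) (sym c₂≡c₁))
  ... | no _      | yes _ = refl
  ... | no _      | no c₂≢c₂ = ⊥-elim (c₂≢c₂ refl)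

  retractU-other : ∀ {x} p → x ≢ c₁ → x ≢ c₂ → retractU (inj₁ (x , p)) ≡ b
  retractU-other {x} _ x≢c₁ x≢c₂ with x L′.≡? c₁ | x L′.≡? c₂
  ... | yes x≡c₁ | _        = ⊥-elim (x≢c₁ x≡c₁)
  ... | no _     | yes x≡c₂ = ⊥-elim (x≢c₂ x≡c₂)
  ... | no _     | no _     = refl

  retractL-mono : ∀ s s′ → s ≼ s′ → retractL s ⊑L retractL s′
  retractL-mono (inj₁ _) (inj₁ _) x⊑y = x⊑y
  retractL-mono (inj₁ (x , _)) (inj₂ _) _ = t-top x
  retractL-mono (inj₂ _) (inj₂ _) _ = L′.⊑-refl t

  private
    retractU-above-c₁ : ∀ {p} s → inj₁ (c₁ , p) ≼ s → a₁ ⊑U retractU s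
    retractU-above-c₁ (inj₁ (y , q)) c₁⊑y with L′.above-coatom t-top (proj₁ coatoms) c₁⊑y
    ... | inj₁ refl = U′.⊑-reflexive (sym (retractU-c₁ q))
    ... | inj₂ y≡t  = ⊥-elim (lower-elim q y≡t)
    retractU-above-c₁ (inj₂ _) (inj₁ (_ , a₁⊑v)) = a₁⊑v
    retractU-above-c₁ (inj₂ _) (inj₂ (c₁⊑c₂ , _)) = ⊥-elim (c₁⋢c₂ c₁⊑c₂)

    retractU-above-c₂ : ∀ {p} s → inj₁ (c₂ , p) ≼ s → a₂ ⊑U retractU s
    retractU-above-c₂ (inj₁ (y , q)) c₂⊑y with L′.above-coatom t-top (proj₁ (proj₂ coatoms)) c₂⊑y
    ... | inj₁ refl = U′.⊑-reflexive (sym (retractU-c₂ q))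
    ... | inj₂ y≡t  = ⊥-elim (lower-elim q y≡t)
    retractU-above-c₂ (inj₂ _) (inj₂ (_ , a₂⊑v)) = a₂⊑v
    retractU-above-c₂ (inj₂ _) (inj₁ (c₂⊑c₁ , _)) = ⊥-elim (c₂⋢c₁ c₂⊑c₁)

  retractU-mono : ∀ s s′ → s ≼ s′ → retractU s ⊑U retractU s′
  retractU-mono (inj₂ _) (inj₂ _) u⊑v = u⊑v
  retractU-mono (inj₁ (x , _)) s′ x≼s′ with x L′.≡? c₁ | x L′.≡? c₂
  ... | yes refl | _        = retractU-above-c₁ s′ x≼s′
  ... | no _     | yes refl = retractU-above-c₂ s′ x≼s′
  ... | no _     | no _     = b-bot _

  private
    embedL′ : ∀ x → Dec (x ≡ t) → Carrier S
    embedL′ x (yes _)  = top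
    embedL′ x (no x≢t) = inj₁ (x , lower-intro x≢t)

  embedL : Carrier L → Carrier S
  embedL x = embedL′ x (x L′.≡? t)

  embedL-lower : ∀ x → embedL (proj₁ x) ≡ inj₁ x
  embedL-lower (x , p) = embedL′-lower (x L′.≡? t)
    where
    embedL′-lower : ∀ d → embedL′ x d ≡ inj₁ (x , p)
    embedL′-lower (yes x≡t) = ⊥-elim (lower-elim p x≡t)
    embedL′-lower (no _)    = cong inj₁ (subtype-≡ refl)

  embedL-top : embedL t ≡ top
  embedL-top with t L′.≡? t
  ... | yes _   = refl
  ... | no t≢t  = ⊥-elim (t≢t refl)

  retractL-embedL : ∀ x → retractL (embedL x) ≡ x
  retractL-embedL x with x L′.≡? t
  ... | yes x≡t = sym x≡t
  ... | no _    = refl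

  embedL-mono : ∀ x y → x ⊑L y → embedL x ≼ embedL y
  embedL-mono x y x⊑y with x L′.≡? t | y L′.≡? t
  ... | dx       | yes _   = top-isTop (embedL′ x dx)
  ... | yes refl | no y≢t  = ⊥-elim (y≢t (L′.⊑-antisym y t (t-top y) x⊑y))
  ... | no _     | no _    = x⊑y

  bot≢t : L′.bot ≢ t
  bot≢t bot≡t = c₁≢t (L′.⊑-antisym c₁ t (t-top c₁) (subst (_⊑L c₁) bot≡t (L′.bot-isBot c₁)))

  bottom : Carrier S
  bottom = inj₁ (L′.bot , lower-intro bot≢t)

  bottom-isBot : IsBot S bottom
  bottom-isBot (inj₁ (x , _)) = L′.bot-isBot x
  bottom-isBot (inj₂ (v , q)) with above-atom-upper q
  ... | inj₁ a₁⊑v = inj₁ (L′.bot-isBot c₁ , a₁⊑v)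
  ... | inj₂ a₂⊑v = inj₂ (L′.bot-isBot c₂ , a₂⊑v)

  retractU-bottom : retractU bottom ≡ b
  retractU-bottom = retractU-other (lower-intro bot≢t) (λ e → c₁⋢c₂ (subst (_⊑L c₂) e (L′.bot-isBot c₂)))
                                                      (λ e → c₂⋢c₁ (subst (_⊑L c₁) e (L′.bot-isBot c₁)))

  -- a₁, a₂ live on as c₁, c₂; b has no copy in S and goes to its bottom, which keeps embedU monotone.
  embedU : Carrier U → Carrier S
  embedU u with upperView u
  ... | is-b _  = bottom
  ... | is-a₁ _ = inj₁ c₁↓
  ... | is-a₂ _ = inj₁ c₂↓
  ... | upper q = inj₂ (u , q)

  embedU-b : embedU b ≡ bottom
  embedU-b with upperView b
  ... | is-b _   = refl
  ... | is-a₁ e  = ⊥-elim (a₁≢b (sym e))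
  ... | is-a₂ e  = ⊥-elim (a₂≢b (sym e))
  ... | upper q  = ⊥-elim (proj₁ (upper-elim q) refl)

  embedU-a₁ : embedU a₁ ≡ inj₁ c₁↓
  embedU-a₁ with upperView a₁
  ... | is-b e   = ⊥-elim (a₁≢b e)
  ... | is-a₁ _  = refl
  ... | is-a₂ e  = ⊥-elim (proj₁ (proj₂ (proj₂ atoms)) e)
  ... | upper q  = ⊥-elim (proj₁ (proj₂ (upper-elim q)) refl)

  embedU-a₂ : embedU a₂ ≡ inj₁ c₂↓
  embedU-a₂ with upperView a₂
  ... | is-b e   = ⊥-elim (a₂≢b e)
  ... | is-a₁ e  = ⊥-elim (proj₁ (proj₂ (proj₂ atoms)) (sym e))
  ... | is-a₂ _  = refl
  ... | upper q  = ⊥-elim (proj₂ (proj₂ (upper-elim q)) refl)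

  embedU-upper : ∀ v → embedU (proj₁ v) ≡ inj₂ v
  embedU-upper (v , q) with upperView v
  ... | is-b e   = ⊥-elim (proj₁ (upper-elim q) e)
  ... | is-a₁ e  = ⊥-elim (proj₁ (proj₂ (upper-elim q)) e)
  ... | is-a₂ e  = ⊥-elim (proj₂ (proj₂ (upper-elim q)) e)
  ... | upper _  = cong inj₂ (subtype-≡ refl)

  retractU-embedU : ∀ u → retractU (embedU u) ≡ u
  retractU-embedU u with upperView u
  ... | is-b refl  = retractU-bottom
  ... | is-a₁ refl = retractU-c₁ (proj₂ c₁↓)
  ... | is-a₂ refl = retractU-c₂ (proj₂ c₂↓)
  ... | upper _    = refl

  upper-upward-closed : ∀ {u v} → T (isUpper u) → u ⊑U v → T (isUpper v)
  upper-upward-closed {u} {v} q u⊑v = upper-intro v≢b v≢a₁ v≢a₂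
    where
    v≢b : v ≢ b
    v≢b refl = proj₁ (upper-elim q) (below-b u⊑v)
    v≢a₁ : v ≢ a₁
    v≢a₁ refl = upper-not-below-atom q (proj₁ atoms) u⊑v
    v≢a₂ : v ≢ a₂
    v≢a₂ refl = upper-not-below-atom q (proj₁ (proj₂ atoms)) u⊑v

  private
    embedU-above-atom : ∀ {a v} → IsAtom U a → (∀ w → a ⊑U proj₁ w → embedU a ≼ inj₂ w) → a ⊑U v → embedU a ≼ embedU v
    embedU-above-atom {a} {v} a-atom link a⊑v with v U′.≡? a
    ... | yes refl = ≼-refl (embedU a)
    ... | no v≢a   = subst (embedU a ≼_) (sym (embedU-upper (v , r))) (link (v , r) a⊑v)
      where r = strictly-above-atom⇒upper a-atom a⊑v v≢a

  embedU-mono : ∀ u v → u ⊑U v → embedU u ≼ embedU v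
  embedU-mono u v u⊑v with upperView u
  ... | is-b refl  = bottom-isBot (embedU v)
  ... | is-a₁ refl = subst (_≼ embedU v) embedU-a₁ (embedU-above-atom (proj₁ atoms)
                       (λ w a₁⊑w → subst (_≼ inj₂ w) (sym embedU-a₁) (inj₁ (L′.⊑-refl c₁ , a₁⊑w))) u⊑v)
  ... | is-a₂ refl = subst (_≼ embedU v) embedU-a₂ (embedU-above-atom (proj₁ (proj₂ atoms))
                       (λ w a₂⊑w → subst (_≼ inj₂ w) (sym embedU-a₂) (inj₂ (L′.⊑-refl c₂ , a₂⊑w))) u⊑v)
  ... | upper q    = subst (inj₂ (u , q) ≼_) (sym (embedU-upper (v , upper-upward-closed q u⊑v))) u⊑v

  lowerRetract : Retract L S
  lowerRetract = record { embed = embedL ; retract = retractL ; embed-mono = embedL-mono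
                        ; retract-mono = retractL-mono ; retract-embed = retractL-embedL }

  upperRetract : Retract U S
  upperRetract = record { embed = embedU ; retract = retractU ; embed-mono = embedU-mono
                        ; retract-mono = retractU-mono ; retract-embed = retractU-embedU }

  LowerImage : Carrier S → Set
  LowerImage s = (s ≡ top) ⊎ (∃[ y ] s ≡ inj₁ y)

  lowerImage-embed : ∀ x → LowerImage (embedL x)
  lowerImage-embed x with x L′.≡? t
  ... | yes refl = inj₁ refl
  ... | no x≢t   = inj₂ ((x , lower-intro x≢t) , refl)

  lowerImage-fixed : ∀ {s} → LowerImage s → s ≡ embedL (retractL s)
  lowerImage-fixed (inj₁ refl)       = sym embedL-top
  lowerImage-fixed (inj₂ (y , refl)) = sym (embedL-lower y)

  data UpperImage (s : Carrier S) : Set where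
    at-bottom : s ≡ bottom → UpperImage s
    at-c₁     : s ≡ inj₁ c₁↓ → UpperImage s
    at-c₂     : s ≡ inj₁ c₂↓ → UpperImage s
    at-upper  : ∀ v → s ≡ inj₂ v → UpperImage s

  upperImage-embed : ∀ u → UpperImage (embedU u)
  upperImage-embed u with upperView u
  ... | is-b refl  = at-bottom refl
  ... | is-a₁ refl = at-c₁ refl
  ... | is-a₂ refl = at-c₂ refl
  ... | upper q    = at-upper (u , q) refl

  upperImage-fixed : ∀ {s} → UpperImage s → s ≡ embedU (retractU s)
  upperImage-fixed (at-bottom refl)  = sym (trans (cong embedU retractU-bottom) embedU-b)
  upperImage-fixed (at-c₁ refl)      = sym (trans (cong embedU (retractU-c₁ (proj₂ c₁↓))) embedU-a₁)
  upperImage-fixed (at-c₂ refl)      = sym (trans (cong embedU (retractU-c₂ (proj₂ c₂↓))) embedU-a₂)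
  upperImage-fixed (at-upper v refl) = sym (embedU-upper v)

-- Isomorphisms between the two vertical 2-sums

module _ {L U : Str} (D : Summands L U) (a₁′ a₂′ : Carrier U) where
  open Summands D

  Compatible : Aut L → Aut U → Set
  Compatible α β = (Fixes (α ⟨$⟩_) c₁ c₂ × (β ⟨$⟩ a₁ ≡ a₁′) × (β ⟨$⟩ a₂ ≡ a₂′))
                 ⊎ (Swaps (α ⟨$⟩_) c₁ c₂ × (β ⟨$⟩ a₁ ≡ a₂′) × (β ⟨$⟩ a₂ ≡ a₁′))

compatible-sym : ∀ {L U} {D : Summands L U} {a₁′ a₂′} (atoms′ : TwoAtoms U a₁′ a₂′) {α β} →
                 Compatible D a₁′ a₂′ α β →
                 Compatible (withAtoms D a₁′ a₂′ atoms′) (Summands.a₁ D) (Summands.a₂ D) (≅-sym α) (≅-sym β)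
compatible-sym _ {α} {β} (inj₁ ((e₁ , e₂) , e₃ , e₄)) =
  inj₁ ((Iso.from-to≡ α e₁ , Iso.from-to≡ α e₂) , Iso.from-to≡ β e₃ , Iso.from-to≡ β e₄)
compatible-sym _ {α} {β} (inj₂ ((e₁ , e₂) , e₃ , e₄)) =
  inj₂ ((Iso.from-to≡ α e₂ , Iso.from-to≡ α e₁) , Iso.from-to≡ β e₄ , Iso.from-to≡ β e₃)

module Extension {L U : Str} (D : Summands L U) {a₁′ a₂′ : Carrier U} (atoms′ : TwoAtoms U a₁′ a₂′)
                 (α : Aut L) (β : Aut U) (compatible : Compatible D a₁′ a₂′ α β) where
  module A = TwoSum D
  module B = TwoSum (withAtoms D a₁′ a₂′ atoms′)
  open Summands D
  module α = Iso α
  module β = Iso β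

  α-t : α ⟨$⟩ t ≡ t
  α-t = A.L′.top-unique (α.to-top t t-top) t-top

  β-b : β ⟨$⟩ b ≡ b
  β-b = A.U′.bot-unique (β.to-bot b b-bot) b-bot

  β-avoids-atoms : ∀ {u} → u ≢ a₁ → u ≢ a₂ → (β ⟨$⟩ u ≢ a₁′) × (β ⟨$⟩ u ≢ a₂′)
  β-avoids-atoms {u} u≢a₁ u≢a₂ = avoid compatible
    where
    avoid : Compatible D a₁′ a₂′ α β → (β ⟨$⟩ u ≢ a₁′) × (β ⟨$⟩ u ≢ a₂′)
    avoid (inj₁ (_ , e₁ , e₂)) = (λ e → u≢a₁ (β.to-injective (trans e (sym e₁)))) ,
                                 (λ e → u≢a₂ (β.to-injective (trans e (sym e₂))))
    avoid (inj₂ (_ , e₁ , e₂)) = (λ e → u≢a₂ (β.to-injective (trans e (sym e₂)))) ,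
                                 (λ e → u≢a₁ (β.to-injective (trans e (sym e₁))))

  extend-upper : ∀ {u} → T (A.isUpper u) → T (B.isUpper (β ⟨$⟩ u))
  extend-upper q = B.upper-intro (λ e → u≢b (β.to-injective (trans e (sym β-b))))
                                 (proj₁ (β-avoids-atoms u≢a₁ u≢a₂)) (proj₂ (β-avoids-atoms u≢a₁ u≢a₂))
    where
    u≢b = proj₁ (A.upper-elim q)
    u≢a₁ = proj₁ (proj₂ (A.upper-elim q))
    u≢a₂ = proj₂ (proj₂ (A.upper-elim q))

  extend : Carrier A.S → Carrier B.S
  extend (inj₁ (x , p)) = inj₁ (α ⟨$⟩ x , B.lower-intro λ e → A.lower-elim p (α.to-injective (trans e (sym α-t))))
  extend (inj₂ (u , q)) = inj₂ (β ⟨$⟩ u , extend-upper q)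

  private
    link : ∀ {x c c′ a a′ v} → α ⟨$⟩ c ≡ c′ → β ⟨$⟩ a ≡ a′ → Defs._≤_ L x c → Defs._≤_ U a v →
           Defs._≤_ L (α ⟨$⟩ x) c′ × Defs._≤_ U a′ (β ⟨$⟩ v)
    link refl refl x⊑c a⊑v = α.to-mono _ _ x⊑c , β.to-mono _ _ a⊑v

  extend-mono : ∀ s s′ → A._≼_ s s′ → B._≼_ (extend s) (extend s′)
  extend-mono (inj₁ (x , _)) (inj₁ (y , _)) x⊑y = α.to-mono x y x⊑y
  extend-mono (inj₂ (u , _)) (inj₂ (v , _)) u⊑v = β.to-mono u v u⊑v
  extend-mono (inj₁ _) (inj₂ _) x≼v = across compatible x≼v
    where
    across : ∀ {x v} → Compatible D a₁′ a₂′ α β →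
             (Defs._≤_ L x c₁ × Defs._≤_ U a₁ v) ⊎ (Defs._≤_ L x c₂ × Defs._≤_ U a₂ v) →
             (Defs._≤_ L (α ⟨$⟩ x) c₁ × Defs._≤_ U a₁′ (β ⟨$⟩ v)) ⊎ (Defs._≤_ L (α ⟨$⟩ x) c₂ × Defs._≤_ U a₂′ (β ⟨$⟩ v))
    across (inj₁ ((f₁ , _) , e₁ , _)) (inj₁ (x⊑c₁ , a₁⊑v)) = inj₁ (link f₁ e₁ x⊑c₁ a₁⊑v)
    across (inj₁ ((_ , f₂) , _ , e₂)) (inj₂ (x⊑c₂ , a₂⊑v)) = inj₂ (link f₂ e₂ x⊑c₂ a₂⊑v)
    across (inj₂ ((s₁ , _) , e₁ , _)) (inj₁ (x⊑c₁ , a₁⊑v)) = inj₂ (link s₁ e₁ x⊑c₁ a₁⊑v)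
    across (inj₂ ((_ , s₂) , _ , e₂)) (inj₂ (x⊑c₂ , a₂⊑v)) = inj₁ (link s₂ e₂ x⊑c₂ a₂⊑v)

extension : ∀ {L U} (D : Summands L U) {a₁′ a₂′} (atoms′ : TwoAtoms U a₁′ a₂′) (α : Aut L) (β : Aut U) →
            Compatible D a₁′ a₂′ α β → TwoSum.S D ≅ TwoSum.S (withAtoms D a₁′ a₂′ atoms′)
extension D atoms′ α β compatible =
  ≅-from-monotone-inverses E.extend E⁻¹.extend inverseʳ inverseˡ E.extend-mono E⁻¹.extend-mono
  where
  module E = Extension D atoms′ α β compatible
  module E⁻¹ = Extension (withAtoms D _ _ atoms′) (Summands.atoms D) (≅-sym α) (≅-sym β)
                         (compatible-sym {D = D} atoms′ {α} {β} compatible)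
  inverseʳ : ∀ s → E.extend (E⁻¹.extend s) ≡ s
  inverseʳ (inj₁ (x , _)) = cong inj₁ (subtype-≡ (Iso.to-from α x))
  inverseʳ (inj₂ (u , _)) = cong inj₂ (subtype-≡ (Iso.to-from β u))
  inverseˡ : ∀ s → E⁻¹.extend (E.extend s) ≡ s
  inverseˡ (inj₁ (x , _)) = cong inj₁ (subtype-≡ (Iso.from-to α x))
  inverseˡ (inj₂ (u , _)) = cong inj₂ (subtype-≡ (Iso.from-to β u))

module Restriction {L U : Str} (D : Summands L U) {a₁′ a₂′ : Carrier U} (atoms′ : TwoAtoms U a₁′ a₂′)
                   (φ : TwoSum.S D ≅ TwoSum.S (withAtoms D a₁′ a₂′ atoms′)) where
  module A = TwoSum D
  module B = TwoSum (withAtoms D a₁′ a₂′ atoms′)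
  open Summands D
  open Iso φ

  rank-preserved : ∀ s → B.rank (to s) ≡ A.rank s
  rank-preserved = SA.rank-unique _ (isRank-transport φ B.rank-isRank)
    where module SA = Ranked A.S A.S-lattice A.rank A.rank-isRank

  -- φ preserves ranks, and every lower element has smaller rank than every upper one.
  to-lower : ∀ x → ∃[ y ] to (inj₁ x) ≡ inj₁ y
  to-lower (x , p) with to (inj₁ (x , p)) in e
  ... | inj₁ y = y , refl
  ... | inj₂ v = ⊥-elim (<-irrefl refl (≤-<-trans (A.lower-rank≤ (A.lower-elim p)) c₁<x))
    where
    c₁<x : rankL c₁ <ℕ rankL x
    c₁<x = subst (rankL c₁ <ℕ_) (trans (cong B.rank (sym e)) (rank-preserved _)) (s≤s (m≤m+n (rankL c₁) _))

  to-upper : ∀ u → ∃[ v ] to (inj₂ u) ≡ inj₂ v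
  to-upper (u , q) with to (inj₂ (u , q)) in e
  ... | inj₂ v = v , refl
  ... | inj₁ (y , p) = ⊥-elim (<-irrefl refl (≤-<-trans (A.lower-rank≤ (B.lower-elim p)) c₁<y))
    where
    c₁<y : rankL c₁ <ℕ rankL y
    c₁<y = subst (rankL c₁ <ℕ_) (trans (sym (rank-preserved _)) (cong B.rank e)) (s≤s (m≤m+n (rankL c₁) _))

  to-neck : ∀ x → rankL (proj₁ x) ≡ rankL c₁ → (to (inj₁ x) ≡ inj₁ B.c₁↓) ⊎ (to (inj₁ x) ≡ inj₁ B.c₂↓)
  to-neck x rx≡ = B.neck-level (to (inj₁ x)) (trans (rank-preserved (inj₁ x)) rx≡)

  to-top≡top : to A.top ≡ B.top
  to-top≡top = B.top-unique (to-top A.top A.top-isTop)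

  to-bottom≡bottom : to A.bottom ≡ B.bottom
  to-bottom≡bottom = B.≼-antisym _ _ (to-bot A.bottom A.bottom-isBot B.bottom) (B.bottom-isBot (to A.bottom))

  maps-lower : MapsInto A.lowerRetract B.lowerRetract to
  maps-lower x = B.lowerImage-fixed (image (A.lowerImage-embed x))
    where
    image : ∀ {s} → A.LowerImage s → B.LowerImage (to s)
    image (inj₁ refl)       = inj₁ to-top≡top
    image (inj₂ (y , refl)) = inj₂ (to-lower y)

  maps-upper : MapsInto A.upperRetract B.upperRetract to
  maps-upper u = B.upperImage-fixed (image (A.upperImage-embed u))
    where
    neck : ∀ {s} (x : A.Lower) → s ≡ inj₁ x → rankL (proj₁ x) ≡ rankL c₁ → B.UpperImage (to s)
    neck x refl rx≡ with to-neck x rx≡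
    ... | inj₁ e = B.at-c₁ e
    ... | inj₂ e = B.at-c₂ e
    image : ∀ {s} → A.UpperImage s → B.UpperImage (to s)
    image (A.at-bottom refl)  = B.at-bottom to-bottom≡bottom
    image (A.at-c₁ e)         = neck A.c₁↓ e refl
    image (A.at-c₂ e)         = neck A.c₂↓ e A.rank-c₂≡c₁
    image (A.at-upper v refl) = let w , e = to-upper v in B.at-upper w e

  neck-permuted : ((to (inj₁ A.c₁↓) ≡ inj₁ B.c₁↓) × (to (inj₁ A.c₂↓) ≡ inj₁ B.c₂↓))
                ⊎ ((to (inj₁ A.c₁↓) ≡ inj₁ B.c₂↓) × (to (inj₁ A.c₂↓) ≡ inj₁ B.c₁↓))
  neck-permuted with to-neck A.c₁↓ refl | to-neck A.c₂↓ A.rank-c₂≡c₁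
  ... | inj₁ e₁ | inj₂ e₂ = inj₁ (e₁ , e₂)
  ... | inj₂ e₁ | inj₁ e₂ = inj₂ (e₁ , e₂)
  ... | inj₁ e₁ | inj₁ e₂ = ⊥-elim (c₁≢c₂ (cong A.retractL (to-injective (trans e₁ (sym e₂)))))
    where c₁≢c₂ = proj₁ (proj₂ (proj₂ coatoms))
  ... | inj₂ e₁ | inj₂ e₂ = ⊥-elim (c₁≢c₂ (cong A.retractL (to-injective (trans e₁ (sym e₂)))))
    where c₁≢c₂ = proj₁ (proj₂ (proj₂ coatoms))

module _ {L U : Str} (D : Summands L U) {a₁′ a₂′ : Carrier U} (atoms′ : TwoAtoms U a₁′ a₂′)
         (φ : TwoSum.S D ≅ TwoSum.S (withAtoms D a₁′ a₂′ atoms′)) where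
  private
    module R   = Restriction D atoms′ φ
    module R⁻¹ = Restriction (withAtoms D a₁′ a₂′ atoms′) (Summands.atoms D) (≅-sym φ)
    module A = R.A
    module B = R.B

  restrictL : Aut L
  restrictL = restrict-≅ A.lowerRetract B.lowerRetract φ R.maps-lower R⁻¹.maps-lower

  restrictU : Aut U
  restrictU = restrict-≅ A.upperRetract B.upperRetract φ R.maps-upper R⁻¹.maps-upper

  restrictU-upper : ∀ v → restrictU ⟨$⟩ proj₁ v ≡ B.retractU (φ ⟨$⟩ inj₂ v)
  restrictU-upper v = cong (λ s → B.retractU (φ ⟨$⟩ s)) (A.embedU-upper v)

  private
    coatom-image : ∀ {c c′} → φ ⟨$⟩ inj₁ c ≡ inj₁ c′ → restrictL ⟨$⟩ proj₁ c ≡ proj₁ c′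
    coatom-image {c} e = trans (cong (λ s → B.retractL (φ ⟨$⟩ s)) (A.embedL-lower c)) (cong B.retractL e)

    atom-image : ∀ {a c c′ a″} → A.embedU a ≡ inj₁ c → φ ⟨$⟩ inj₁ c ≡ inj₁ c′ → B.retractU (inj₁ c′) ≡ a″ →
                 restrictU ⟨$⟩ a ≡ a″
    atom-image embed≡ e retract≡ = trans (cong (λ s → B.retractU (φ ⟨$⟩ s)) embed≡) (trans (cong B.retractU e) retract≡)

  restrict-compatible : Compatible D a₁′ a₂′ restrictL restrictU
  restrict-compatible with R.neck-permuted
  ... | inj₁ (e₁ , e₂) = inj₁ ((coatom-image e₁ , coatom-image e₂) ,
                              atom-image A.embedU-a₁ e₁ (B.retractU-c₁ (proj₂ B.c₁↓)) ,
                              atom-image A.embedU-a₂ e₂ (B.retractU-c₂ (proj₂ B.c₂↓)))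
  ... | inj₂ (e₁ , e₂) = inj₂ ((coatom-image e₁ , coatom-image e₂) ,
                              atom-image A.embedU-a₁ e₁ (B.retractU-c₂ (proj₂ B.c₂↓)) ,
                              atom-image A.embedU-a₂ e₂ (B.retractU-c₁ (proj₂ B.c₁↓)))

-- Types of the vertical 2-sums

module SumTypes {L U : Str} (D : Summands L U) (L-vi : IsVI L) (U-vi : IsVI U) where
  open TwoSum D

  private
    C2-lift : ∀ {e₁ e₂} → TwoCoatoms U e₁ e₂ → C2 S
    C2-lift pair = _ , _ , twoCoatoms-lift pair

  symCoatoms-lift : ∀ {e₁ e₂} (pair : TwoCoatoms U e₁ e₂) (α : Aut L) (β : Aut U) →
                    Compatible D a₁ a₂ α β → Swaps (β ⟨$⟩_) e₁ e₂ → SymCoatoms S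
  symCoatoms-lift pair α β compatible (e₁ , e₂) =
    _ , _ , twoCoatoms-lift pair , extension D atoms α β compatible , cong inj₂ (subtype-≡ e₁) , cong inj₂ (subtype-≡ e₂)

  symCoatoms-restrict : ∀ {e₁ e₂} (pair : TwoCoatoms U e₁ e₂) → SymCoatoms S →
                        Σ (Aut L) λ α → Σ (Aut U) λ β → Compatible D a₁ a₂ α β × Swaps (β ⟨$⟩_) e₁ e₂
  symCoatoms-restrict pair sym with symCoatoms-swaps sym (twoCoatoms-lift pair)
  ... | f , f₁ , f₂ = restrictL D atoms f , restrictU D atoms f , restrict-compatible D atoms f ,
                      trans (restrictU-upper D atoms f _) (cong retractU f₁) ,
                      trans (restrictU-upper D atoms f _) (cong retractU f₂)

  isCF-of-fixedCoatoms : FixedCoatoms U → IsCF S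
  isCF-of-fixedCoatoms ((e₁ , e₂ , pair) , ¬sym) = isComposition L-vi U-vi , C2-lift pair , C2-lift pair , ¬symS
    where
    ¬symS : ¬ SymCoatoms S
    ¬symS sym = let _ , β , _ , β-swaps = symCoatoms-restrict pair sym in ¬sym (e₁ , e₂ , pair , β , β-swaps)

  -- An automorphism of S swapping its coatoms restricts to a compatible pair whose U-part swaps the
  -- coatoms of U; as L has no coatom swap, that part fixes the atoms, and composed with the H-symmetry
  -- of U it would make U an MX piece.
  isCF-of-MH : ¬ SymCoatoms L → IsMH U → IsCF S
  isCF-of-MH ¬symL ((_ , _ , (e₁ , e₂ , pair)) , ¬X , hsym) = isComposition L-vi U-vi , C2-lift pair , C2-lift pair , ¬symS
    where
    ¬symS : ¬ SymCoatoms S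
    ¬symS sym with symCoatoms-restrict pair sym
    ... | α , _ , inj₂ (α-swaps , _) , _ = ¬symL (c₁ , c₂ , coatoms , α , α-swaps)
    ... | _ , β , inj₁ (_ , β-a₁ , β-a₂) , (β-e₁ , β-e₂) with hSym-swapsBoth hsym atoms pair
    ...   | h , (h-a₁ , h-a₂) , (h-e₁ , h-e₂) =
      ¬X (a₁ , a₂ , e₁ , e₂ , atoms , pair ,
          (≅-trans h β , trans (cong (β ⟨$⟩_) h-a₁) β-a₂ , trans (cong (β ⟨$⟩_) h-a₂) β-a₁ ,
                         trans (cong (β ⟨$⟩_) h-e₁) β-e₂ , trans (cong (β ⟨$⟩_) h-e₂) β-e₁) ,
          (β , β-e₁ , β-e₂ , β-a₁ , β-a₂))

  isCS-of-MC : IsMC U → IsCS S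
  isCS-of-MC ((_ , _ , (_ , _ , pair)) , (_ , ¬symA) , symC) with symCoatoms-swaps symC pair
  ... | g , g-swaps with aut-permutes-atoms g atoms
  ...   | inj₁ (g-a₁ , g-a₂) =
    isComposition L-vi U-vi , C2-lift pair , symCoatoms-lift pair (≅-refl L) g (inj₁ ((refl , refl) , g-a₁ , g-a₂)) g-swaps
  ...   | inj₂ g-swapsAtoms = ⊥-elim (¬symA (a₁ , a₂ , atoms , g , g-swapsAtoms))

  isCS-of-MX : IsMX U → IsCS S
  isCS-of-MX ((_ , _ , (_ , _ , pair)) , xsym) with xSym-swapsCoatoms xsym atoms pair
  ... | g , g-swaps , (g-a₁ , g-a₂) =
    isComposition L-vi U-vi , C2-lift pair , symCoatoms-lift pair (≅-refl L) g (inj₁ ((refl , refl) , g-a₁ , g-a₂)) g-swaps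

  isCS-of-MH : SymCoatoms L → IsMH U → IsCS S
  isCS-of-MH symL ((_ , _ , (_ , _ , pair)) , _ , hsym) with symCoatoms-swaps symL coatoms | hSym-swapsBoth hsym atoms pair
  ... | α , α-swaps | h , (h-a₁ , h-a₂) , h-swaps =
    isComposition L-vi U-vi , C2-lift pair , symCoatoms-lift pair α h (inj₂ (α-swaps , h-a₁ , h-a₂)) h-swaps

  isCN-of-C≥3 : C≥3 U → IsCN S
  isCN-of-C≥3 c≥3 = isComposition L-vi U-vi , C≥3-lift c≥3

module Classification (L U : Str) (hL : IsPiece L ⊎ IsComposition L) (hU : IsPiece U)
                      (t c₁ c₂ : Carrier L) (b a₁ a₂ : Carrier U) (t-top : IsTop L t)
                      (coatoms : TwoCoatoms L c₁ c₂) (b-bot : IsBot U b) (atoms : TwoAtoms U a₁ a₂) where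
  private
    graded-L : IsGradedVI L
    graded-L = [ proj₁ , proj₁ ]′ hL

    graded-U : IsGradedVI U
    graded-U = proj₁ hU

    module L′ = Ranked L (proj₁ graded-L) (proj₁ (proj₁ (proj₂ graded-L))) (proj₂ (proj₁ (proj₂ graded-L)))
    module U′ = Ranked U (proj₁ graded-U) (proj₁ (proj₁ (proj₂ graded-U))) (proj₂ (proj₁ (proj₂ graded-U)))

    3≤rank-L : 3 ≤ℕ proj₁ (proj₁ (proj₂ graded-L)) t
    3≤rank-L = [ (λ piece → L′.rank≥3 t-top (proj₁ (proj₂ (proj₂ piece))))
               , (λ composition → L′.neck⇒rank≥3 t-top (proj₂ composition)) ]′ hL

    D : Summands L U
    D = record
      { L-lattice = proj₁ graded-L ; rankL = proj₁ (proj₁ (proj₂ graded-L)) ; rankL-isRank = proj₂ (proj₁ (proj₂ graded-L))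
      ; U-lattice = proj₁ graded-U ; rankU = proj₁ (proj₁ (proj₂ graded-U)) ; rankU-isRank = proj₂ (proj₁ (proj₂ graded-U))
      ; t = t ; c₁ = c₁ ; c₂ = c₂ ; t-top = t-top ; coatoms = coatoms ; 3≤rank-L = 3≤rank-L
      ; b = b ; a₁ = a₁ ; a₂ = a₂ ; b-bot = b-bot ; atoms = atoms
      ; tU = U′.top ; tU-top = U′.top-isTop ; 3≤rank-U = U′.rank≥3 U′.top-isTop (proj₁ (proj₂ (proj₂ hU)))
      }

    module Types (D′ : Summands L U) = SumTypes D′ (proj₂ (proj₂ graded-L)) (proj₂ (proj₂ graded-U))

  S₁ S₂ : Str
  S₁ = V2Sum L U t c₁ c₂ b a₁ a₂
  S₂ = V2Sum L U t c₁ c₂ b a₂ a₁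

  private
    both : {X : Str → Set₁} → (∀ D′ → X (TwoSum.S D′)) → X S₁ × X S₂
    both typeOf = typeOf D , typeOf (withAtoms D a₂ a₁ (exactPair-swap atoms))

  sums-≅-by-atoms : Σ (Aut U) (λ f → Swaps (f ⟨$⟩_) a₁ a₂) → S₁ ≅ S₂
  sums-≅-by-atoms (f , f-a₁ , f-a₂) = extension D (exactPair-swap atoms) (≅-refl L) f (inj₁ ((refl , refl) , f-a₁ , f-a₂))

  sums-≅-by-coatoms : Σ (Aut L) (λ α → Swaps (α ⟨$⟩_) c₁ c₂) → S₁ ≅ S₂
  sums-≅-by-coatoms (α , α-swaps) = extension D (exactPair-swap atoms) α (≅-refl U) (inj₂ (α-swaps , refl , refl))

  sums-≇ : ¬ SymAtoms U → ¬ SymCoatoms L → ¬ (S₁ ≅ S₂)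
  sums-≇ ¬symA ¬symC φ = contradict (restrict-compatible D (exactPair-swap atoms) φ)
    where
    α = restrictL D (exactPair-swap atoms) φ
    β = restrictU D (exactPair-swap atoms) φ
    contradict : Compatible D a₂ a₁ α β → ⊥
    contradict (inj₁ (_ , β-swaps)) = ¬symA (a₁ , a₂ , atoms , β , β-swaps)
    contradict (inj₂ (α-swaps , _)) = ¬symC (c₁ , c₂ , coatoms , α , α-swaps)

  private
    fixedCoatoms-of-part1 : (IsCF L ⊎ IsBF L ⊎ IsMF L ⊎ IsMA L) → ¬ SymCoatoms L
    fixedCoatoms-of-part1 (inj₁ cf)               = proj₂ (proj₂ (proj₂ cf))
    fixedCoatoms-of-part1 (inj₂ (inj₁ bf))        = proj₂ (proj₂ bf)
    fixedCoatoms-of-part1 (inj₂ (inj₂ (inj₁ mf))) = proj₂ (proj₂ (proj₂ mf))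
    fixedCoatoms-of-part1 (inj₂ (inj₂ (inj₂ ma))) = proj₂ (proj₂ (proj₂ ma))

    coatomSwap-of-part2 : (IsCS L ⊎ IsBS L ⊎ IsMC L ⊎ IsMX L ⊎ IsMH L) → Σ (Aut L) λ α → Swaps (α ⟨$⟩_) c₁ c₂
    coatomSwap-of-part2 (inj₁ cs)                      = symCoatoms-swaps (proj₂ (proj₂ cs)) coatoms
    coatomSwap-of-part2 (inj₂ (inj₁ bs))               = symCoatoms-swaps (proj₂ bs) coatoms
    coatomSwap-of-part2 (inj₂ (inj₂ (inj₁ mc)))        = symCoatoms-swaps (proj₂ (proj₂ mc)) coatoms
    coatomSwap-of-part2 (inj₂ (inj₂ (inj₂ (inj₁ mx)))) =
      let g , swaps , _ = xSym-swapsCoatoms (proj₂ mx) (proj₂ (proj₂ (proj₁ (proj₂ (proj₁ mx))))) coatoms in g , swaps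
    coatomSwap-of-part2 (inj₂ (inj₂ (inj₂ (inj₂ mh)))) =
      let f , _ , swaps = hSym-swapsBoth (proj₂ (proj₂ mh)) (proj₂ (proj₂ (proj₁ (proj₂ (proj₁ mh))))) coatoms in f , swaps

  part1 : (IsCF L ⊎ IsBF L ⊎ IsMF L ⊎ IsMA L) →
            (IsMF U → TwoClasses IsCF S₁ S₂)
          × (IsMA U → OneClass IsCF S₁ S₂)
          × (IsMC U → TwoClasses IsCS S₁ S₂)
          × (IsMX U → OneClass IsCS S₁ S₂)
          × (IsMH U → OneClass IsCF S₁ S₂)
          × (IsTF U → TwoClasses IsCN S₁ S₂)
          × (IsTS U → OneClass IsCN S₁ S₂)
  part1 h =
    (λ (_ , (_ , ¬symA) , fixedC) → sums-≇ ¬symA ¬symC , both {IsCF} λ D′ → Types.isCF-of-fixedCoatoms D′ fixedC) ,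
    (λ (_ , symA , fixedC) →
       sums-≅-by-atoms (symAtoms-swaps symA atoms) , both {IsCF} λ D′ → Types.isCF-of-fixedCoatoms D′ fixedC) ,
    (λ { mc@(_ , (_ , ¬symA) , _) → sums-≇ ¬symA ¬symC , both {IsCS} λ D′ → Types.isCS-of-MC D′ mc }) ,
    (λ { mx@(_ , xsym) → sums-≅-by-atoms (xSym-swapsAtoms xsym atoms) , both {IsCS} λ D′ → Types.isCS-of-MX D′ mx }) ,
    (λ { mh@((_ , _ , (_ , _ , coatomsU)) , _ , hsym) →
       let f , f-swaps , _ = hSym-swapsBoth hsym atoms coatomsU in
       sums-≅-by-atoms (f , f-swaps) , both {IsCF} λ D′ → Types.isCF-of-MH D′ ¬symC mh }) ,
    (λ ((_ , _ , manyC) , (_ , ¬symA)) → sums-≇ ¬symA ¬symC , both {IsCN} λ D′ → Types.isCN-of-C≥3 D′ manyC) ,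
    (λ ((_ , _ , manyC) , symA) →
       sums-≅-by-atoms (symAtoms-swaps symA atoms) , both {IsCN} λ D′ → Types.isCN-of-C≥3 D′ manyC)
    where
    ¬symC : ¬ SymCoatoms L
    ¬symC = fixedCoatoms-of-part1 h

  part2 : (IsCS L ⊎ IsBS L ⊎ IsMC L ⊎ IsMX L ⊎ IsMH L) →
            ((IsMF U ⊎ IsMA U) → OneClass IsCF S₁ S₂)
          × ((IsMC U ⊎ IsMX U ⊎ IsMH U) → OneClass IsCS S₁ S₂)
          × ((IsTF U ⊎ IsTS U) → OneClass IsCN S₁ S₂)
  part2 h =
    (λ u → sums-≅-by-coatoms swap , both {IsCF} λ D′ → Types.isCF-of-fixedCoatoms D′ (fixedCoatoms u)) ,
    (λ where
      (inj₁ mc)        → sums-≅-by-coatoms swap , both {IsCS} λ D′ → Types.isCS-of-MC D′ mc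
      (inj₂ (inj₁ mx)) → sums-≅-by-coatoms swap , both {IsCS} λ D′ → Types.isCS-of-MX D′ mx
      (inj₂ (inj₂ mh)) → sums-≅-by-coatoms swap , both {IsCS} λ D′ → Types.isCS-of-MH D′ (c₁ , c₂ , coatoms , swap) mh) ,
    (λ u → sums-≅-by-coatoms swap , both {IsCN} λ D′ → Types.isCN-of-C≥3 D′ (manyCoatoms u))
    where
    swap : Σ (Aut L) λ α → Swaps (α ⟨$⟩_) c₁ c₂
    swap = coatomSwap-of-part2 h
    fixedCoatoms : IsMF U ⊎ IsMA U → FixedCoatoms U
    fixedCoatoms (inj₁ mf) = proj₂ (proj₂ mf)
    fixedCoatoms (inj₂ ma) = proj₂ (proj₂ ma)
    manyCoatoms : IsTF U ⊎ IsTS U → C≥3 U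
    manyCoatoms (inj₁ tf) = proj₂ (proj₂ (proj₁ tf))
    manyCoatoms (inj₂ ts) = proj₂ (proj₂ (proj₁ ts))

lemma2 : (L U : Str) → (IsPiece L ⊎ IsComposition L) → IsPiece U →
    (∀ (t c₁ c₂ : Carrier L) (b a₁ a₂ : Carrier U) →
      IsTop L t → TwoCoatoms L c₁ c₂ → IsBot U b → TwoAtoms U a₁ a₂ →
      -- part (1)
      ((IsCF L ⊎ IsBF L ⊎ IsMF L ⊎ IsMA L) →
          (IsMF U → TwoClasses IsCF (V2Sum L U t c₁ c₂ b a₁ a₂) (V2Sum L U t c₁ c₂ b a₂ a₁))
        × (IsMA U → OneClass IsCF (V2Sum L U t c₁ c₂ b a₁ a₂) (V2Sum L U t c₁ c₂ b a₂ a₁))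
        × (IsMC U → TwoClasses IsCS (V2Sum L U t c₁ c₂ b a₁ a₂) (V2Sum L U t c₁ c₂ b a₂ a₁))
        × (IsMX U → OneClass IsCS (V2Sum L U t c₁ c₂ b a₁ a₂) (V2Sum L U t c₁ c₂ b a₂ a₁))
        × (IsMH U → OneClass IsCF (V2Sum L U t c₁ c₂ b a₁ a₂) (V2Sum L U t c₁ c₂ b a₂ a₁))
        × (IsTF U → TwoClasses IsCN (V2Sum L U t c₁ c₂ b a₁ a₂) (V2Sum L U t c₁ c₂ b a₂ a₁))
        × (IsTS U → OneClass IsCN (V2Sum L U t c₁ c₂ b a₁ a₂) (V2Sum L U t c₁ c₂ b a₂ a₁)))
      -- part (2)
      × ((IsCS L ⊎ IsBS L ⊎ IsMC L ⊎ IsMX L ⊎ IsMH L) →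
          ((IsMF U ⊎ IsMA U) → OneClass IsCF (V2Sum L U t c₁ c₂ b a₁ a₂) (V2Sum L U t c₁ c₂ b a₂ a₁))
        × ((IsMC U ⊎ IsMX U ⊎ IsMH U) → OneClass IsCS (V2Sum L U t c₁ c₂ b a₁ a₂) (V2Sum L U t c₁ c₂ b a₂ a₁))
        × ((IsTF U ⊎ IsTS U) → OneClass IsCN (V2Sum L U t c₁ c₂ b a₁ a₂) (V2Sum L U t c₁ c₂ b a₂ a₁))))
    -- part (3): L has no pair of exactly two coatoms, so no vertical 2-sum exists
    × ((IsCN L ⊎ IsTF L ⊎ IsTS L) → ¬ (Σ (Carrier L) λ c₁ → Σ (Carrier L) λ c₂ → TwoCoatoms L c₁ c₂))
lemma2 L U hL hU =
  (λ t c₁ c₂ b a₁ a₂ t-top coatoms b-bot atoms →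
     let open Classification L U hL hU t c₁ c₂ b a₁ a₂ t-top coatoms b-bot atoms in part1 , part2) ,
  λ where
    (inj₁ cn)        → ¬twoCoatoms {L} (proj₂ cn)
    (inj₂ (inj₁ tf)) → ¬twoCoatoms {L} (proj₂ (proj₂ (proj₁ tf)))
    (inj₂ (inj₂ ts)) → ¬twoCoatoms {L} (proj₂ (proj₂ (proj₁ ts)))
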